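{- Constructor has a strategy ensuring that $g(n,K_3,S_4) \ge \dfrac{n}{3}(1+o(1))$ as $n\to\infty$.
   Context: The Constructor-Blocker game with parameters $n$, a graph $H$ and a graph $F$: Constructor and Blocker alternately claim previously unclaimed edges of $K_n$, Constructor moving first. Constructor may only claim an edge if afterwards her graph (edges she has claimed) contains no subgraph isomorphic to $F$; Blocker may claim any unclaimed edge. The game ends when Constructor cannot claim any more edges or all edges are claimed. The score is the number of copies of $H$ in Constructor's final graph; Constructor maximizes, Blocker minimizes, and $g(n,H,F)$ is the score under optimal play. $K_3$ is the triangle and $S_4$ is the star with $4$ leaves. -}

module Defs where

open import Data.Nat using (ℕ; _≤_; _<ᵇ_)
open import Data.Bool using (Bool; true; false; _∧_; _∨_; if_then_else_; T)
open import Data.Fin using (Fin; zero; suc; toℕ; _≟_)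
open import Data.List using (List; []; _∷_; map; concatMap; allFin)
open import Data.Bool.ListAction using (any)
open import Data.Nat.ListAction using (sum)
open import Data.Product using (_×_; _,_; ∃-syntax)
open import Relation.Nullary using (¬_)
open import Relation.Nullary.Decidable using (⌊_⌋)
open import Relation.Binary.PropositionalEquality using (_≡_; _≢_)
open import Function.Definitions using (Injective)

-- A graph on the vertex set Fin n (vertices of K_n), given by a list of edges.
-- An edge {u,v} is present if (u , v) or (v , u) occurs in the list.
Graph : ℕ → Set
Graph n = List (Fin n × Fin n)

adjᵇ : ∀ {n} → Graph n → Fin n → Fin n → Bool
adjᵇ G u v = any (λ e → (⌊ Data.Product.proj₁ e ≟ u ⌋ ∧ ⌊ Data.Product.proj₂ e ≟ v ⌋)
                      ∨ (⌊ Data.Product.proj₁ e ≟ v ⌋ ∧ ⌊ Data.Product.proj₂ e ≟ u ⌋)) G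

Adj : ∀ {n} → Graph n → Fin n → Fin n → Set
Adj G u v = T (adjᵇ G u v)

ContainsS4 : ∀ {n} → Graph n → Set
ContainsS4 {n} G =
  ∃[ f ] (Injective {A = Fin 5} {B = Fin n} _≡_ _≡_ f × ((i : Fin 4) → Adj G (f zero) (f (suc i))))

triangles : ∀ {n} → Graph n → ℕ
triangles {n} G =
  sum (concatMap (λ a → concatMap (λ b → map (λ c → ind a b c) (allFin n)) (allFin n)) (allFin n))
  where
    ind : Fin n → Fin n → Fin n → ℕ
    ind a b c = if (toℕ a <ᵇ toℕ b) ∧ (toℕ b <ᵇ toℕ c)
                   ∧ adjᵇ G a b ∧ adjᵇ G b c ∧ adjᵇ G a c
                then 1 else 0

Unclaimed : ∀ {n} → Graph n → Graph n → Fin n → Fin n → Set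
Unclaimed C B u v = u ≢ v × ¬ Adj C u v × ¬ Adj B u v

LegalC : ∀ {n} → Graph n → Graph n → Fin n → Fin n → Set
LegalC C B u v = Unclaimed C B u v × ¬ ContainsS4 ((u , v) ∷ C)

Over : ∀ {n} → Graph n → Graph n → Set
Over C B = ¬ (∃[ u ] ∃[ v ] LegalC C B u v)

-- Constructor has a strategy ensuring final score ≥ s from the given
-- position, with Constructor (CWins) resp. Blocker (BWins) to move.
mutual
  data CWins {n : ℕ} (s : ℕ) : Graph n → Graph n → Set where
    c-end  : ∀ {C B} → Over C B → s ≤ triangles C → CWins s C B
    c-move : ∀ {C B} (u v : Fin n) → LegalC C B u v
           → BWins s ((u , v) ∷ C) B → CWins s C B

  data BWins {n : ℕ} (s : ℕ) : Graph n → Graph n → Set where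
    b-end  : ∀ {C B} → Over C B → s ≤ triangles C → BWins s C B
    b-move : ∀ {C B} → ¬ Over C B
           → ((u v : Fin n) → Unclaimed C B u v → CWins s C ((u , v) ∷ B))
           → BWins s C B

g≥ : (n s : ℕ) → Set
g≥ n s = CWins {n} s [] []

module Submission where

-- Constructor keeps her graph of maximum degree 3, so it never contains S₄, and keeps two ports:
-- leaves of her graph available for the next triangle. A round takes fresh vertices x, q, r
-- (untouched by her, of Blocker-degree at most D, not Blocker-adjacent to the ports). She claims xq;
-- Blocker's reply touches the pairs at one port only, so at the other port p both xp and qp remain
-- free. She claims xr: if Blocker does not take qr she closes xqr, and otherwise she claims xp,
-- threatening both pq and pr. Each round thus yields a new triangle, uses at most three new vertices
-- and leaves two ports of degree 1. Vertices of Blocker-degree > D number at most 2b/(D + 1), where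
-- b ≤ 3n/2 is the number of Blocker's edges, and a port of Blocker-degree > K is replaced by a fresh
-- edge, paid for by Blocker's edges at the ports. Hence the rounds only stop after (1 - O(1/D)) n/3.

open import Defs
open import Data.Bool using (Bool; true; false; if_then_else_; T; _∧_; _∨_)
open import Data.Bool.ListAction using (any)
open import Data.Bool.Properties using (T-∧; T-∨; T?)
open import Data.Empty using (⊥-elim)
open import Data.Fin using (Fin; zero; suc; _≟_; toℕ)
open import Data.Fin.Properties using (pigeonhole; toℕ-injective; any?; all?)
import Data.Fin.Properties as Fin
open import Data.List as List using (List; []; _∷_; _++_; [_]; length; map; concatMap; allFin; tabulate)
open import Data.List.Membership.Propositional using (_∈_)
open import Data.List.Membership.Propositional.Properties using (∈-++⁺ˡ; ∈-++⁺ʳ)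
open import Data.List.Relation.Unary.All as All using (All; []; _∷_)
open import Data.List.Relation.Unary.All.Properties using (¬Any⇒All¬)
open import Data.List.Relation.Unary.Any as Any using (Any; here; there)
open import Data.List.Relation.Unary.Any.Properties using (any⁺; any⁻; lookup-index)
open import Data.Nat using (ℕ; zero; suc; _+_; _*_; _∸_; _≤_; _<_; z≤n; s≤s; _<ᵇ_; _≤?_; _/_; _%_)
open import Data.Nat.DivMod using (m/n*n≤m; m≡m%n+[m/n]*n; m%n<n)
open import Data.Nat.ListAction using (sum)
open import Data.Nat.ListAction.Properties using (sum-++)
open import Data.Nat.Properties hiding (_≟_)
open import Data.Nat.Tactic.RingSolver using (solve-∀)
open import Algebra.Properties.Semiring.Sum +-*-semiring
  using (∑-distrib-+; *-distribˡ-sum; sum-cong-≗) renaming (sum to ∑)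
open import Data.Product using (_×_; _,_; proj₁; proj₂; ∃; ∃-syntax)
open import Data.Sum as Sum using (_⊎_; inj₁; inj₂)
open import Data.Unit using (tt)
import Data.Vec.Functional as Vector
open import Function using (_∘_; _$_; id)
open import Function.Bundles using (Equivalence)
open import Function.Definitions using (Injective)
open import Relation.Binary using (tri<; tri≈; tri>)
open import Relation.Binary.PropositionalEquality
  using (_≡_; _≢_; _≗_; refl; sym; trans; cong; cong₂; subst; subst₂; module ≡-Reasoning)
open import Relation.Nullary using (¬_; Dec; yes; no)
open import Relation.Nullary.Decidable
  using (⌊_⌋; _×-dec_; _⊎-dec_; _→-dec_; ¬?; map′; toWitness; fromWitness; decidable-stable)

private variable
  n : ℕ
  u v w a b : Fin n
  e : Fin n × Fin n
  G : Graph n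

-- Adjacency and degree

Joins : Fin n × Fin n → Fin n → Fin n → Set
Joins e u v = (proj₁ e ≡ u × proj₂ e ≡ v) ⊎ (proj₁ e ≡ v × proj₂ e ≡ u)

Joins? : (e : Fin n × Fin n) (u v : Fin n) → Dec (Joins e u v)
Joins? e u v = (proj₁ e ≟ u ×-dec proj₂ e ≟ v) ⊎-dec (proj₁ e ≟ v ×-dec proj₂ e ≟ u)

Joins-sym : Joins e u v → Joins e v u
Joins-sym (inj₁ (p , q)) = inj₂ (p , q)
Joins-sym (inj₂ (p , q)) = inj₁ (p , q)

Joins-unique : ∀ {u' v' : Fin n} → Joins e u v → Joins e u' v' → (u ≡ u' × v ≡ v') ⊎ (u ≡ v' × v ≡ u')
Joins-unique (inj₁ (refl , refl)) (inj₁ (refl , refl)) = inj₁ (refl , refl)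
Joins-unique (inj₁ (refl , refl)) (inj₂ (refl , refl)) = inj₂ (refl , refl)
Joins-unique (inj₂ (refl , refl)) (inj₁ (refl , refl)) = inj₂ (refl , refl)
Joins-unique (inj₂ (refl , refl)) (inj₂ (refl , refl)) = inj₁ (refl , refl)

-- Definitionally the test that Defs.adjᵇ applies to each edge.
joinsᵇ : Fin n × Fin n → Fin n → Fin n → Bool
joinsᵇ e u v = (⌊ proj₁ e ≟ u ⌋ ∧ ⌊ proj₂ e ≟ v ⌋) ∨ (⌊ proj₁ e ≟ v ⌋ ∧ ⌊ proj₂ e ≟ u ⌋)

T-joinsᵇ⁻ : T (joinsᵇ e u v) → Joins e u v
T-joinsᵇ⁻ t = Sum.map both both (Equivalence.to T-∨ t)
  where
  both : ∀ {x y x' y' : Fin _} → T (⌊ x ≟ x' ⌋ ∧ ⌊ y ≟ y' ⌋) → x ≡ x' × y ≡ y'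
  both {x} {y} {x'} {y'} t with Equivalence.to (T-∧ {⌊ x ≟ x' ⌋}) t
  ... | p , q = toWitness {a? = x ≟ x'} p , toWitness {a? = y ≟ y'} q

T-joinsᵇ⁺ : Joins e u v → T (joinsᵇ e u v)
T-joinsᵇ⁺ j = Equivalence.from T-∨ (Sum.map both both j)
  where
  both : ∀ {x y x' y' : Fin _} → x ≡ x' × y ≡ y' → T (⌊ x ≟ x' ⌋ ∧ ⌊ y ≟ y' ⌋)
  both {x} {y} {x'} {y'} (p , q) =
    Equivalence.from (T-∧ {⌊ x ≟ x' ⌋}) (fromWitness {a? = x ≟ x'} p , fromWitness {a? = y ≟ y'} q)

Adj⇒Any : (G : Graph n) → Adj G u v → Any (λ e → Joins e u v) G
Adj⇒Any {u = u} {v} G p = Any.map T-joinsᵇ⁻ (any⁻ (λ e → joinsᵇ e u v) G p)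

Any⇒Adj : (G : Graph n) → Any (λ e → Joins e u v) G → Adj G u v
Any⇒Adj {u = u} {v} G p = any⁺ (λ e → joinsᵇ e u v) (Any.map T-joinsᵇ⁺ p)

Adj-here : (G : Graph n) → Joins e u v → Adj (e ∷ G) u v
Adj-here G j = Any⇒Adj (_ ∷ G) (here j)

Adj-∷-head : (G : Graph n) (a b : Fin n) → Adj ((a , b) ∷ G) a b
Adj-∷-head G a b = Adj-here {e = a , b} G (inj₁ (refl , refl))

Adj-there : (G : Graph n) → Adj G u v → Adj (e ∷ G) u v
Adj-there {e = e} G p = Any⇒Adj (e ∷ G) (there (Adj⇒Any G p))

Adj-∷⁻ : (G : Graph n) → Adj (e ∷ G) u v → Joins e u v ⊎ Adj G u v
Adj-∷⁻ G p with Adj⇒Any (_ ∷ G) p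
... | here j  = inj₁ j
... | there q = inj₂ (Any⇒Adj G q)

Adj-sym : (G : Graph n) → Adj G u v → Adj G v u
Adj-sym G = Any⇒Adj G ∘ Any.map Joins-sym ∘ Adj⇒Any G

δ : Fin n → Fin n → ℕ
δ a v = if ⌊ a ≟ v ⌋ then 1 else 0

nbrs : Graph n → Fin n → List (Fin n)
nbrs []            v = []
nbrs ((a , b) ∷ G) v =
  (if ⌊ a ≟ v ⌋ then [ b ] else []) ++ (if ⌊ b ≟ v ⌋ then [ a ] else []) ++ nbrs G v

deg : Graph n → Fin n → ℕ
deg G v = length (nbrs G v)

deg-∷ : (G : Graph n) (a b v : Fin n) → deg ((a , b) ∷ G) v ≡ δ a v + (δ b v + deg G v)
deg-∷ G a b v with a ≟ v | b ≟ v
... | yes _ | yes _ = refl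
... | yes _ | no  _ = refl
... | no  _ | yes _ = refl
... | no  _ | no  _ = refl

δ-refl : (a : Fin n) → δ a a ≡ 1
δ-refl a with a ≟ a
... | yes _   = refl
... | no  a≢a = ⊥-elim (a≢a refl)

δ-≢ : a ≢ v → δ a v ≡ 0
δ-≢ {a = a} {v} a≢v with a ≟ v
... | yes a≡v = ⊥-elim (a≢v a≡v)
... | no  _   = refl

deg-∷-≢ : (G : Graph n) → v ≢ a → v ≢ b → deg ((a , b) ∷ G) v ≡ deg G v
deg-∷-≢ {v = v} {a} {b} G v≢a v≢b
  rewrite deg-∷ G a b v | δ-≢ (v≢a ∘ sym) | δ-≢ (v≢b ∘ sym) = refl

deg-∷-fst : (G : Graph n) → a ≢ b → deg ((a , b) ∷ G) a ≡ suc (deg G a)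
deg-∷-fst {a = a} {b} G a≢b rewrite deg-∷ G a b a | δ-refl a | δ-≢ (a≢b ∘ sym) = refl

deg-∷-snd : (G : Graph n) → a ≢ b → deg ((a , b) ∷ G) b ≡ suc (deg G b)
deg-∷-snd {a = a} {b} G a≢b rewrite deg-∷ G a b b | δ-refl b | δ-≢ a≢b = refl

deg-∷-mono : (G : Graph n) (a b v : Fin n) → deg G v ≤ deg ((a , b) ∷ G) v
deg-∷-mono G a b v rewrite deg-∷ G a b v | sym (+-assoc (δ a v) (δ b v) (deg G v)) =
  m≤n+m (deg G v) (δ a v + δ b v)

deg-∷-≤ : (G : Graph n) (w : Fin n) → a ≢ b → deg ((a , b) ∷ G) w ≤ suc (deg G w)
deg-∷-≤ {a = a} {b} G w a≢b with w ≟ a | w ≟ b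
... | yes refl | yes refl = ⊥-elim (a≢b refl)
... | yes refl | no  _    = ≤-reflexive (deg-∷-fst G a≢b)
... | no  _    | yes refl = ≤-reflexive (deg-∷-snd G a≢b)
... | no  w≢a  | no  w≢b  = ≤-trans (≤-reflexive (deg-∷-≢ G w≢a w≢b)) (n≤1+n _)

∈-if-refl : (a w : Fin n) → w ∈ (if ⌊ a ≟ a ⌋ then [ w ] else [])
∈-if-refl a w with a ≟ a
... | yes _   = here refl
... | no  a≢a = ⊥-elim (a≢a refl)

Adj⇒∈nbrs : (G : Graph n) → Adj G v w → w ∈ nbrs G v
Adj⇒∈nbrs ((a , b) ∷ G) p with Adj-∷⁻ {e = a , b} G p
... | inj₁ (inj₁ (refl , refl)) = ∈-++⁺ˡ (∈-if-refl a b)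
... | inj₁ (inj₂ (refl , refl)) = ∈-++⁺ʳ (if ⌊ a ≟ b ⌋ then [ b ] else []) (∈-++⁺ˡ (∈-if-refl b a))
... | inj₂ q = ∈-++⁺ʳ (if ⌊ a ≟ _ ⌋ then [ b ] else []) (∈-++⁺ʳ (if ⌊ b ≟ _ ⌋ then [ a ] else []) (Adj⇒∈nbrs G q))

-- Pigeonhole on the positions of the neighbours in the list nbrs G v.
injective-nbrs⇒≤deg : ∀ {m} (G : Graph n) (f : Fin m → Fin n) → Injective _≡_ _≡_ f →
                      (∀ i → Adj G v (f i)) → m ≤ deg G v
injective-nbrs⇒≤deg {v = v} G f f-inj adj = ≮⇒≥ λ deg<m →
  let (i , j , i<j , same-position) = pigeonhole deg<m (Any.index ∘ mem)
  in Fin.<⇒≢ i<j (f-inj (trans (lookup-index (mem i))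
                           (trans (cong (List.lookup (nbrs G v)) same-position)
                                  (sym (lookup-index (mem j))))))
  where
  mem : ∀ i → f i ∈ nbrs G v
  mem i = Adj⇒∈nbrs G (adj i)

two-nbrs⇒2≤deg : (G : Graph n) → Adj G v a → Adj G v b → a ≢ b → 2 ≤ deg G v
two-nbrs⇒2≤deg {a = a} {b} G va vb a≢b = injective-nbrs⇒≤deg G f f-inj adj
  where
  f : Fin 2 → Fin _
  f zero    = a
  f (suc _) = b
  f-inj : Injective _≡_ _≡_ f
  f-inj {zero}     {zero}     _   = refl
  f-inj {zero}     {suc zero} a≡b = ⊥-elim (a≢b a≡b)
  f-inj {suc zero} {zero}     b≡a = ⊥-elim (a≢b (sym b≡a))
  f-inj {suc zero} {suc zero} _   = refl
  adj : ∀ i → Adj G _ (f i)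
  adj zero       = va
  adj (suc zero) = vb

Subcubic : Graph n → Set
Subcubic {n} G = (v : Fin n) → deg G v ≤ 3

subcubic⇒¬S4 : Subcubic G → ¬ ContainsS4 G
subcubic⇒¬S4 {G = G} Δ≤3 (f , f-inj , adj) = 4≰3 (≤-trans leaves≤deg (Δ≤3 (f zero)))
  where
  leaves≤deg : 4 ≤ deg G (f zero)
  leaves≤deg = injective-nbrs⇒≤deg G (f ∘ suc) (Fin.suc-injective ∘ f-inj) adj
  4≰3 : ¬ 4 ≤ 3
  4≰3 (s≤s (s≤s (s≤s ())))

Subcubic-∷ : (G : Graph n) → Subcubic G → deg G a ≤ 2 → deg G b ≤ 2 → a ≢ b → Subcubic ((a , b) ∷ G)
Subcubic-∷ {a = a} {b} G Δ≤3 da db a≢b v with v ≟ a | v ≟ b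
... | yes refl | _        = subst (_≤ 3) (sym (deg-∷-fst G a≢b)) (s≤s da)
... | no  _    | yes refl = subst (_≤ 3) (sym (deg-∷-snd G a≢b)) (s≤s db)
... | no  v≢a  | no  v≢b  = subst (_≤ 3) (sym (deg-∷-≢ G v≢a v≢b)) (Δ≤3 v)

legal-move : ∀ (C B : Graph n) → Unclaimed C B a b → Subcubic C → deg C a ≤ 2 → deg C b ≤ 2 →
             LegalC C B a b
legal-move {a = a} {b} C B unclaimed@(a≢b , _) Δ≤3 da db =
  unclaimed , subcubic⇒¬S4 {G = (a , b) ∷ C} (Subcubic-∷ C Δ≤3 da db a≢b)

Adj⇒1≤deg : (G : Graph n) → Adj G v w → 1 ≤ deg G v
Adj⇒1≤deg G p = injective-nbrs⇒≤deg G (λ _ → _) (λ { {zero} {zero} _ → refl }) (λ _ → p)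

isolated⇒¬Adj : (G : Graph n) → deg G v ≡ 0 → ¬ Adj G v w
isolated⇒¬Adj G deg≡0 p = 1+n≰n (subst (1 ≤_) deg≡0 (Adj⇒1≤deg G p))

isolated⇒≢ : (G : Graph n) → deg G a ≡ 0 → 1 ≤ deg G b → a ≢ b
isolated⇒≢ G deg≡0 1≤deg refl = 1+n≰n (subst (1 ≤_) deg≡0 1≤deg)

¬Joins-fst : a ≢ u → a ≢ v → ¬ Joins (u , v) a b
¬Joins-fst a≢u a≢v (inj₁ (u≡a , _)) = a≢u (sym u≡a)
¬Joins-fst a≢u a≢v (inj₂ (_ , v≡a)) = a≢v (sym v≡a)

¬Joins-snd : b ≢ u → b ≢ v → ¬ Joins (u , v) a b
¬Joins-snd b≢u b≢v (inj₁ (_ , v≡b)) = b≢v (sym v≡b)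
¬Joins-snd b≢u b≢v (inj₂ (u≡b , _)) = b≢u (sym u≡b)

Unclaimed-sym : ∀ (C B : Graph n) → Unclaimed C B a b → Unclaimed C B b a
Unclaimed-sym C B (a≢b , ¬Cab , ¬Bab) = a≢b ∘ sym , ¬Cab ∘ Adj-sym C , ¬Bab ∘ Adj-sym B

Unclaimed-∷ᶜ : ∀ (C B : Graph n) e → Unclaimed C B a b → ¬ Joins e a b → Unclaimed (e ∷ C) B a b
Unclaimed-∷ᶜ C B e (a≢b , ¬Cab , ¬Bab) ¬e = a≢b , Sum.[ ¬e , ¬Cab ] ∘ Adj-∷⁻ C , ¬Bab

Unclaimed-∷ᴮ : ∀ (C B : Graph n) e → Unclaimed C B a b → ¬ Joins e a b → Unclaimed C (e ∷ B) a b
Unclaimed-∷ᴮ C B e (a≢b , ¬Cab , ¬Bab) ¬e = a≢b , ¬Cab , Sum.[ ¬e , ¬Bab ] ∘ Adj-∷⁻ B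

data _⊑_ {n : ℕ} (G : Graph n) : Graph n → Set where
  ⊑-refl : G ⊑ G
  ⊑-step : ∀ {H e} → G ⊑ H → G ⊑ (e ∷ H)

⊑-lift : ∀ {ℓ r} {X : Set ℓ} (_R_ : X → X → Set r) → (∀ {x} → x R x) → (∀ {x y z} → x R y → y R z → x R z) →
         (f : Graph n → X) → (∀ e G → f G R f (e ∷ G)) → ∀ {G H} → G ⊑ H → f G R f H
⊑-lift _R_ R-refl R-trans f step ⊑-refl = R-refl
⊑-lift _R_ R-refl R-trans f step (⊑-step {e = e} G⊑H) = R-trans (⊑-lift _R_ R-refl R-trans f step G⊑H) (step e _)

Adj-⊑ : ∀ {G H : Graph n} → G ⊑ H → Adj G u v → Adj H u v
Adj-⊑ {u = u} {v} = ⊑-lift (λ X Y → X → Y) id (λ f g → g ∘ f) (λ G → Adj G u v) (λ e G → Adj-there {e = e} G)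

deg-⊑ : ∀ {G H : Graph n} → G ⊑ H → deg G v ≤ deg H v
deg-⊑ {v = v} = ⊑-lift _≤_ ≤-refl ≤-trans (λ G → deg G v) (λ (a , b) G → deg-∷-mono G a b v)

-- Sums over Fin n and the number of triangles

∑-mono : {f g : Fin n → ℕ} → (∀ i → f i ≤ g i) → ∑ f ≤ ∑ g
∑-mono {zero}  f≤g = z≤n
∑-mono {suc n} f≤g = +-mono-≤ (f≤g zero) (∑-mono (f≤g ∘ suc))

∑-mono-< : {f g : Fin n → ℕ} → (∀ i → f i ≤ g i) → (j : Fin n) → f j < g j → ∑ f < ∑ g
∑-mono-< {suc n} f≤g zero    fj<gj = +-mono-<-≤ fj<gj (∑-mono (f≤g ∘ suc))
∑-mono-< {suc n} f≤g (suc j) fj<gj = +-mono-≤-< (f≤g zero) (∑-mono-< (f≤g ∘ suc) j fj<gj)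

term≤∑ : (f : Fin n → ℕ) (i : Fin n) → f i ≤ ∑ f
term≤∑ f zero    = m≤m+n _ _
term≤∑ f (suc i) = ≤-trans (term≤∑ (f ∘ suc) i) (m≤n+m _ _)

∑-const : ∀ n k → ∑ {n} (λ _ → k) ≡ k * n
∑-const zero    k = sym (*-zeroʳ k)
∑-const (suc n) k = trans (cong (k +_) (∑-const n k)) (sym (*-suc k n))

∑-≡0 : {f : Fin n → ℕ} → (∀ i → f i ≡ 0) → ∑ f ≡ 0
∑-≡0 {zero}  f≡0 = refl
∑-≡0 {suc n} f≡0 = cong₂ _+_ (f≡0 zero) (∑-≡0 (f≡0 ∘ suc))

δ-suc : (a v : Fin n) → δ (suc a) (suc v) ≡ δ a v
δ-suc a v with a ≟ v
... | yes _ = refl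
... | no  _ = refl

∑-δ : (a : Fin n) → ∑ (δ a) ≡ 1
∑-δ {suc n} zero    = cong suc (∑-const n 0)
∑-δ {suc n} (suc a) = trans (sum-cong-≗ (δ-suc a)) (∑-δ a)

if-mono : ∀ {x y : Bool} → (T x → T y) → (if x then 1 else 0) ≤ (if y then 1 else 0)
if-mono {false}         _    = z≤n
if-mono {true}  {true}  _    = ≤-refl
if-mono {true}  {false} x⇒y = ⊥-elim (x⇒y tt)

if-T : ∀ {x : Bool} → T x → (if x then 1 else 0) ≡ 1
if-T {true} _ = refl

if-¬T : ∀ {x : Bool} → ¬ T x → (if x then 1 else 0) ≡ 0
if-¬T {false} _  = refl
if-¬T {true}  ¬t = ⊥-elim (¬t tt)

sum-map-tabulate : ∀ {A : Set} (f : A → ℕ) (h : Fin n → A) → sum (map f (tabulate h)) ≡ ∑ (f ∘ h)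
sum-map-tabulate {zero}  f h = refl
sum-map-tabulate {suc n} f h = cong (f (h zero) +_) (sum-map-tabulate f (h ∘ suc))

sum-concatMap-tabulate : ∀ {A : Set} (g : A → List ℕ) (h : Fin n → A) →
                         sum (concatMap g (tabulate h)) ≡ ∑ (λ i → sum (g (h i)))
sum-concatMap-tabulate {zero}  g h = refl
sum-concatMap-tabulate {suc n} g h =
  trans (sum-++ (g (h zero)) _) (cong (sum (g (h zero)) +_) (sum-concatMap-tabulate g (h ∘ suc)))

Triangle : Graph n → Fin n → Fin n → Fin n → Set
Triangle G a b c = Adj G a b × Adj G b c × Adj G a c

-- Definitionally the summand of Defs.triangles.
triangleᵇ : Graph n → Fin n → Fin n → Fin n → ℕ
triangleᵇ G a b c =
  if (toℕ a <ᵇ toℕ b) ∧ (toℕ b <ᵇ toℕ c) ∧ adjᵇ G a b ∧ adjᵇ G b c ∧ adjᵇ G a c then 1 else 0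

row : Graph n → Fin n → ℕ
row G a = ∑ λ b → ∑ λ c → triangleᵇ G a b c

triangles≡∑row : (G : Graph n) → triangles G ≡ ∑ (row G)
triangles≡∑row {n} G =
  trans (sum-concatMap-tabulate (λ a → concatMap (λ b → map (triangleᵇ G a b) (allFin n)) (allFin n)) id)
        (sum-cong-≗ λ a → trans (sum-concatMap-tabulate (λ b → map (triangleᵇ G a b) (allFin n)) id)
                                (sum-cong-≗ λ b → sum-map-tabulate (triangleᵇ G a b) id))

private
  T-∧⁵⁻ : ∀ {x y z u w} → T (x ∧ y ∧ z ∧ u ∧ w) → T x × T y × T z × T u × T w
  T-∧⁵⁻ {true} {true} {true} {true} {true} _ = tt , tt , tt , tt , tt

  T-∧⁵⁺ : ∀ {x y z u w} → T x × T y × T z × T u × T w → T (x ∧ y ∧ z ∧ u ∧ w)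
  T-∧⁵⁺ {true} {true} {true} {true} {true} _ = tt

triangleᵇ-∷ : (G : Graph n) (e : Fin n × Fin n) (a b c : Fin n) → triangleᵇ G a b c ≤ triangleᵇ (e ∷ G) a b c
triangleᵇ-∷ G e a b c = if-mono λ t →
  let (a<b , b<c , ab , bc , ac) = T-∧⁵⁻ {toℕ a <ᵇ toℕ b} {toℕ b <ᵇ toℕ c} {adjᵇ G a b} t
  in T-∧⁵⁺ (a<b , b<c , Adj-there {e = e} G ab , Adj-there {e = e} G bc , Adj-there {e = e} G ac)

row-⊑ : ∀ {G H : Graph n} → G ⊑ H → (a : Fin n) → row G a ≤ row H a
row-⊑ G⊑H a = ⊑-lift _≤_ ≤-refl ≤-trans (λ G → row G a)
  (λ e G → ∑-mono λ b → ∑-mono λ c → triangleᵇ-∷ G e a b c) G⊑H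

triangles-⊑ : ∀ {G H : Graph n} → G ⊑ H → triangles G ≤ triangles H
triangles-⊑ {G = G} {H} G⊑H rewrite triangles≡∑row G | triangles≡∑row H = ∑-mono (row-⊑ G⊑H)

ordered-triangle⇒1≤row : (G : Graph n) {a b c : Fin n} → toℕ a < toℕ b → toℕ b < toℕ c →
                         Triangle G a b c → 1 ≤ row G a
ordered-triangle⇒1≤row G {a} {b} {c} a<b b<c (ab , bc , ac) =
  ≤-trans (≤-reflexive (sym counted)) (≤-trans (term≤∑ _ c) (term≤∑ (λ b → ∑ (triangleᵇ G a b)) b))
  where
  counted : triangleᵇ G a b c ≡ 1
  counted = if-T (T-∧⁵⁺ {toℕ a <ᵇ toℕ b} {toℕ b <ᵇ toℕ c} {adjᵇ G a b} {adjᵇ G b c} {adjᵇ G a c}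
                        (<⇒<ᵇ a<b , <⇒<ᵇ b<c , ab , bc , ac))

deg≤1⇒row≡0 : (G : Graph n) {t : Fin n} → deg G t ≤ 1 → row G t ≡ 0
deg≤1⇒row≡0 G {t} deg≤1 = ∑-≡0 λ b → ∑-≡0 λ c → if-¬T λ tbc →
  let (_ , b<c , tb , _ , tc) = T-∧⁵⁻ {toℕ t <ᵇ toℕ b} {toℕ b <ᵇ toℕ c} {adjᵇ G t b} tbc
  in <⇒≱ (s≤s deg≤1) (two-nbrs⇒2≤deg G tb tc (Fin.<⇒≢ (<ᵇ⇒< (toℕ b) (toℕ c) b<c)))

Triangle-swap₁₂ : (G : Graph n) {a b c : Fin n} → Triangle G a b c → Triangle G b a c
Triangle-swap₁₂ G (ab , bc , ac) = Adj-sym G ab , ac , bc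

Triangle-swap₂₃ : (G : Graph n) {a b c : Fin n} → Triangle G a b c → Triangle G a c b
Triangle-swap₂₃ G (ab , bc , ac) = ac , Adj-sym G bc , ab

-- The least of the three vertices counts the triangle in its row.
triangle⇒1≤row : (G : Graph n) {a b c : Fin n} → a ≢ b → b ≢ c → a ≢ c → Triangle G a b c →
                 ∃[ t ] ((t ≡ a ⊎ t ≡ b ⊎ t ≡ c) × 1 ≤ row G t)
triangle⇒1≤row G {a} {b} {c} a≢b b≢c a≢c abc
  with <-cmp (toℕ a) (toℕ b) | <-cmp (toℕ b) (toℕ c) | <-cmp (toℕ a) (toℕ c)
... | tri≈ _ a≡b _ | _ | _ = ⊥-elim (a≢b (toℕ-injective a≡b))
... | _ | tri≈ _ b≡c _ | _ = ⊥-elim (b≢c (toℕ-injective b≡c))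
... | _ | _ | tri≈ _ a≡c _ = ⊥-elim (a≢c (toℕ-injective a≡c))
... | tri< a<b _ _ | tri< b<c _ _ | _ = a , inj₁ refl , ordered-triangle⇒1≤row G a<b b<c abc
... | tri< a<b _ _ | tri> _ _ c<b | tri< a<c _ _ =
  a , inj₁ refl , ordered-triangle⇒1≤row G a<c c<b (Triangle-swap₂₃ G abc)
... | tri< a<b _ _ | tri> _ _ c<b | tri> _ _ c<a =
  c , inj₂ (inj₂ refl) , ordered-triangle⇒1≤row G c<a a<b (Triangle-swap₁₂ G (Triangle-swap₂₃ G abc))
... | tri> _ _ b<a | tri< b<c _ _ | tri< a<c _ _ =
  b , inj₂ (inj₁ refl) , ordered-triangle⇒1≤row G b<a a<c (Triangle-swap₁₂ G abc)
... | tri> _ _ b<a | tri< b<c _ _ | tri> _ _ c<a =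
  b , inj₂ (inj₁ refl) , ordered-triangle⇒1≤row G b<c c<a (Triangle-swap₂₃ G (Triangle-swap₁₂ G abc))
... | tri> _ _ b<a | tri> _ _ c<b | _ =
  c , inj₂ (inj₂ refl) , ordered-triangle⇒1≤row G c<b b<a (Triangle-swap₁₂ G (Triangle-swap₂₃ G (Triangle-swap₁₂ G abc)))

-- A vertex of degree ≤ 1 lies in no triangle, so the row of the least vertex grows.
new-triangle : ∀ {G H : Graph n} {a b c : Fin n} → G ⊑ H → a ≢ b → b ≢ c → a ≢ c → Triangle H a b c →
               deg G a ≤ 1 → deg G b ≤ 1 → deg G c ≤ 1 → suc (triangles G) ≤ triangles H
new-triangle {G = G} {H} G⊑H a≢b b≢c a≢c abc da db dc
  rewrite triangles≡∑row G | triangles≡∑row H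
  with triangle⇒1≤row H a≢b b≢c a≢c abc
... | t , t∈abc , 1≤row = ∑-mono-< (row-⊑ G⊑H) t (subst (_< row H t) (sym (deg≤1⇒row≡0 G (deg-t t∈abc))) 1≤row)
  where
  deg-t : ∀ {t} → t ≡ _ ⊎ t ≡ _ ⊎ t ≡ _ → deg G t ≤ 1
  deg-t (inj₁ refl)        = da
  deg-t (inj₂ (inj₁ refl)) = db
  deg-t (inj₂ (inj₂ refl)) = dc

-- Counting vertices

count : (Fin n → Bool) → ℕ
count p = ∑ λ v → if p v then 1 else 0

count-mono : {p q : Fin n → Bool} → (∀ v → T (p v) → T (q v)) → count p ≤ count q
count-mono p⇒q = ∑-mono λ v → if-mono (p⇒q v)

count-∨ : (p q : Fin n → Bool) → count (λ v → p v ∨ q v) ≤ count p + count q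
count-∨ p q = ≤-trans (∑-mono λ v → if-∨ (p v) (q v))
                      (≤-reflexive (∑-distrib-+ (λ v → if p v then 1 else 0) (λ v → if q v then 1 else 0)))
  where
  if-∨ : ∀ x y → (if x ∨ y then 1 else 0) ≤ (if x then 1 else 0) + (if y then 1 else 0)
  if-∨ true  y = s≤s z≤n
  if-∨ false y = ≤-refl

count-all : (p : Fin n → Bool) → (∀ v → T (p v)) → count p ≡ n
count-all {zero}  p all-p = refl
count-all {suc n} p all-p with p zero | all-p zero
... | true | _ = cong suc (count-all (p ∘ suc) (all-p ∘ suc))

memberᵇ : List (Fin n) → Fin n → Bool
memberᵇ L v = any (λ x → ⌊ x ≟ v ⌋) L

∈⇒memberᵇ : {L : List (Fin n)} {v : Fin n} → v ∈ L → T (memberᵇ L v)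
∈⇒memberᵇ v∈L = any⁺ _ (Any.map (λ v≡x → fromWitness (sym v≡x)) v∈L)

count-memberᵇ : (L : List (Fin n)) → count (memberᵇ L) ≤ length L
count-memberᵇ {n} []      = ≤-reflexive (∑-≡0 {n} λ _ → refl)
count-memberᵇ     (x ∷ L) =
  ≤-trans (count-∨ (λ v → ⌊ x ≟ v ⌋) _) (+-mono-≤ (≤-reflexive (∑-δ x)) (count-memberᵇ L))

count-⊆ : (p : Fin n → Bool) (L : List (Fin n)) → (∀ v → T (p v) → v ∈ L) → count p ≤ length L
count-⊆ p L p⊆L = ≤-trans (count-mono λ v pv → ∈⇒memberᵇ (p⊆L v pv)) (count-memberᵇ L)

count-adj≤deg : (G : Graph n) (w : Fin n) → count (adjᵇ G w) ≤ deg G w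
count-adj≤deg G w = count-⊆ (adjᵇ G w) (nbrs G w) (λ v → Adj⇒∈nbrs G)

handshake : (G : Graph n) → ∑ (deg G) ≡ 2 * length G
handshake {n} []        = ∑-≡0 {n} λ _ → refl
handshake ((a , b) ∷ G) = begin
  ∑ (deg ((a , b) ∷ G))                ≡⟨ sum-cong-≗ (deg-∷ G a b) ⟩
  ∑ (λ v → δ a v + (δ b v + deg G v))  ≡⟨ ∑-distrib-+ (δ a) _ ⟩
  ∑ (δ a) + ∑ (λ v → δ b v + deg G v)  ≡⟨ cong (∑ (δ a) +_) (∑-distrib-+ (δ b) _) ⟩
  ∑ (δ a) + (∑ (δ b) + ∑ (deg G))      ≡⟨ cong₂ (λ x y → x + (y + ∑ (deg G))) (∑-δ a) (∑-δ b) ⟩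
  2 + ∑ (deg G)                        ≡⟨ cong (2 +_) (handshake G) ⟩
  2 + 2 * length G                     ≡⟨ sym (*-suc 2 (length G)) ⟩
  2 * length ((a , b) ∷ G)             ∎
  where open ≡-Reasoning

highᵇ : ℕ → Graph n → Fin n → Bool
highᵇ D G v = D <ᵇ deg G v

high-count : (D : ℕ) (G : Graph n) → suc D * count (highᵇ D G) ≤ 2 * length G
high-count D G = begin
  suc D * count (highᵇ D G)                         ≡⟨ *-distribˡ-sum (suc D) (λ v → if highᵇ D G v then 1 else 0) ⟩
  ∑ (λ v → suc D * (if highᵇ D G v then 1 else 0)) ≤⟨ ∑-mono high≤deg ⟩
  ∑ (deg G)                                         ≡⟨ handshake G ⟩
  2 * length G                                      ∎
  where
  open ≤-Reasoning
  high≤deg : ∀ v → suc D * (if highᵇ D G v then 1 else 0) ≤ deg G v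
  high≤deg v with D <ᵇ deg G v in high
  ... | true  = ≤-trans (≤-reflexive (*-identityʳ (suc D))) (<ᵇ⇒< D (deg G v) (subst T (sym high) tt))
  ... | false = ≤-trans (≤-reflexive (*-zeroʳ (suc D))) z≤n

subcubic⇒edges : (G : Graph n) → Subcubic G → 2 * length G ≤ 3 * n
subcubic⇒edges {n} G Δ≤3 = begin
  2 * length G    ≡⟨ handshake G ⟨
  ∑ (deg G)       ≤⟨ ∑-mono Δ≤3 ⟩
  ∑ {n} (λ _ → 3) ≡⟨ ∑-const n 3 ⟩
  3 * n           ∎
  where open ≤-Reasoning

usedᵇ : Graph n → Fin n → Bool
usedᵇ G v = 0 <ᵇ deg G v

used : Graph n → ℕ
used G = count (usedᵇ G)

used-∷⁻ : (G : Graph n) {a b v : Fin n} → T (usedᵇ ((a , b) ∷ G) v) → T (usedᵇ G v) ⊎ a ≡ v ⊎ b ≡ v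
used-∷⁻ G {a} {b} {v} t with v ≟ a | v ≟ b
... | yes v≡a | _       = inj₂ (inj₁ (sym v≡a))
... | no  _   | yes v≡b = inj₂ (inj₂ (sym v≡b))
... | no  v≢a | no  v≢b = inj₁ (subst (λ d → T (0 <ᵇ d)) (deg-∷-≢ G v≢a v≢b) t)

usedᵇ⇒1≤deg : (G : Graph n) {v : Fin n} → T (usedᵇ G v) → 1 ≤ deg G v
usedᵇ⇒1≤deg G {v} = <ᵇ⇒< 0 (deg G v)

1≤deg⇒usedᵇ : (G : Graph n) {v : Fin n} → 1 ≤ deg G v → T (usedᵇ G v)
1≤deg⇒usedᵇ G = <⇒<ᵇ

used-∷-≤ : (G : Graph n) (a b : Fin n) (L : List (Fin n)) →
           (∀ {v} → v ≡ a ⊎ v ≡ b → deg G v ≡ 0 → v ∈ L) → used ((a , b) ∷ G) ≤ used G + length L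
used-∷-≤ G a b L isolated∈L =
  ≤-trans (count-mono covered) (≤-trans (count-∨ (usedᵇ G) (memberᵇ L)) (+-monoʳ-≤ (used G) (count-memberᵇ L)))
  where
  covered : ∀ v → T (usedᵇ ((a , b) ∷ G) v) → T (usedᵇ G v ∨ memberᵇ L v)
  covered v t with T? (usedᵇ G v) | used-∷⁻ G t
  ... | yes old | _                = Equivalence.from T-∨ (inj₁ old)
  ... | no  new | inj₁ old         = ⊥-elim (new old)
  ... | no  new | inj₂ endpoint    =
    Equivalence.from T-∨ (inj₂ (∈⇒memberᵇ (isolated∈L (Sum.map sym sym endpoint) (n≤0⇒n≡0 (≮⇒≥ (new ∘ <⇒<ᵇ))))))

usedᵇ-∷ : (G : Graph n) (e : Fin n × Fin n) {v : Fin n} → T (usedᵇ G v) → T (usedᵇ (e ∷ G) v)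
usedᵇ-∷ G (a , b) {v} t = 1≤deg⇒usedᵇ ((a , b) ∷ G) (≤-trans (usedᵇ⇒1≤deg G t) (deg-∷-mono G a b v))

used-∷-isolated : (G : Graph n) (a b : Fin n) → deg G a ≡ 0 → used G < used ((a , b) ∷ G)
used-∷-isolated G a b deg≡0 = ∑-mono-< (λ v → if-mono (usedᵇ-∷ G (a , b))) a
  (subst₂ _<_ (sym (if-¬T unused)) (sym (if-T (1≤deg⇒usedᵇ ((a , b) ∷ G) 1≤deg))) (s≤s z≤n))
  where
  unused : ¬ T (usedᵇ G a)
  unused t = 1+n≰n (subst (1 ≤_) deg≡0 (usedᵇ⇒1≤deg G t))
  1≤deg : 1 ≤ deg ((a , b) ∷ G) a
  1≤deg rewrite deg-∷ G a b a | δ-refl a = s≤s z≤n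

used-⊑ : ∀ {G H : Graph n} → G ⊑ H → used G ≤ used H
used-⊑ = ⊑-lift _≤_ ≤-refl ≤-trans used λ e G → count-mono {p = usedᵇ G} λ v → usedᵇ-∷ G e

used-∷-+2 : (G : Graph n) (a b : Fin n) → used ((a , b) ∷ G) ≤ used G + 2
used-∷-+2 G a b = used-∷-≤ G a b (a ∷ b ∷ []) λ
  { (inj₁ refl) _ → here refl ; (inj₂ refl) _ → there (here refl) }

used-∷-+1 : (G : Graph n) {a : Fin n} (b : Fin n) → 1 ≤ deg G a → used ((a , b) ∷ G) ≤ used G + 1
used-∷-+1 G b a-used = used-∷-≤ G _ b (b ∷ []) λ
  { (inj₁ refl) isolated → ⊥-elim (1+n≰n (subst (1 ≤_) isolated a-used)) ; (inj₂ refl) _ → here refl }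

used-∷-+0 : (G : Graph n) {a b : Fin n} → 1 ≤ deg G a → 1 ≤ deg G b → used ((a , b) ∷ G) ≤ used G
used-∷-+0 G a-used b-used = ≤-trans (used-∷-≤ G _ _ [] λ
  { (inj₁ refl) isolated → ⊥-elim (1+n≰n (subst (1 ≤_) isolated a-used))
  ; (inj₂ refl) isolated → ⊥-elim (1+n≰n (subst (1 ≤_) isolated b-used)) }) (≤-reflexive (+-identityʳ _))

used-[] : used {n} [] ≡ 0
used-[] {n} = ∑-≡0 {n} λ _ → refl

-- Decidability of legal moves and the endgame

any-function? : ∀ m {P : (Fin m → Fin n) → Set} → (∀ {f g} → f ≗ g → P f → P g) →
                (∀ f → Dec (P f)) → Dec (∃ P)
any-function? zero    resp P? = map′ (λ p → _ , p) (λ (f , p) → resp (λ ()) p) (P? λ ())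
any-function? (suc m) resp P? =
  map′ (λ (x , f , p) → x Vector.∷ f , p)
       (λ (f , p) → f zero , f ∘ suc , resp head∷tail p)
       (any? λ x → any-function? m (λ f≗g → resp (cons-cong f≗g)) (λ f → P? (x Vector.∷ f)))
  where
  head∷tail : ∀ {f : Fin (suc m) → Fin n} → f ≗ (f zero Vector.∷ f ∘ suc)
  head∷tail zero    = refl
  head∷tail (suc i) = refl
  cons-cong : ∀ {x} {f g : Fin m → Fin n} → f ≗ g → (x Vector.∷ f) ≗ (x Vector.∷ g)
  cons-cong f≗g zero    = refl
  cons-cong f≗g (suc i) = f≗g i

injective? : ∀ {m} (f : Fin m → Fin n) → Dec (Injective _≡_ _≡_ f)
injective? f = map′ (λ inj {i} {j} → inj i j) (λ inj i j → inj)
                    (all? λ i → all? λ j → (f i ≟ f j) →-dec (i ≟ j))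

ContainsS4? : (G : Graph n) → Dec (ContainsS4 G)
ContainsS4? G = any-function? 5 resp
  (λ f → injective? f ×-dec all? λ i → T? (adjᵇ G (f zero) (f (suc i))))
  where
  resp : ∀ {f g} → f ≗ g → _ → _
  resp f≗g (inj , adj) =
    (λ gi≡gj → inj (trans (f≗g _) (trans gi≡gj (sym (f≗g _))))) ,
    (λ i → subst₂ (Adj G) (f≗g zero) (f≗g (suc i)) (adj i))

Unclaimed? : (C B : Graph n) (u v : Fin n) → Dec (Unclaimed C B u v)
Unclaimed? C B u v = ¬? (u ≟ v) ×-dec ¬? (T? (adjᵇ C u v)) ×-dec ¬? (T? (adjᵇ B u v))

LegalC? : (C B : Graph n) (u v : Fin n) → Dec (LegalC C B u v)
LegalC? C B u v = Unclaimed? C B u v ×-dec ¬? (ContainsS4? ((u , v) ∷ C))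

unclaimedᵇ : Graph n → Graph n → Fin n → Fin n → Bool
unclaimedᵇ C B u v = ⌊ Unclaimed? C B u v ⌋

unclaimed-pairs : Graph n → Graph n → ℕ
unclaimed-pairs C B = ∑ λ u → count (unclaimedᵇ C B u)

unclaimed-pairs-< : ∀ {C B C′ B′ : Graph n} {a b} → (∀ {u v} → Unclaimed C′ B′ u v → Unclaimed C B u v) →
                    Unclaimed C B a b → ¬ Unclaimed C′ B′ a b → unclaimed-pairs C′ B′ < unclaimed-pairs C B
unclaimed-pairs-< {C = C} {B} {C′} {B′} {a} {b} still-unclaimed ab ¬ab′ =
  ∑-mono-< (λ u → count-mono {p = unclaimedᵇ C′ B′ u} λ v → keep) a
    (∑-mono-< {f = λ v → if unclaimedᵇ C′ B′ a v then 1 else 0} (λ v → if-mono keep) b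
      (subst₂ _<_ (sym (if-¬T (¬ab′ ∘ toWitness))) (sym (if-T (fromWitness ab))) (s≤s z≤n)))
  where
  keep : ∀ {u v} → T ⌊ Unclaimed? C′ B′ u v ⌋ → T ⌊ Unclaimed? C B u v ⌋
  keep = fromWitness ∘ still-unclaimed ∘ toWitness

HasMove? : (C B : Graph n) → Dec (∃[ u ] ∃[ v ] LegalC C B u v)
HasMove? C B = any? λ u → any? λ v → LegalC? C B u v

claimᶜ-decreases : (C B : Graph n) {a b : Fin n} → Unclaimed C B a b →
                   unclaimed-pairs ((a , b) ∷ C) B < unclaimed-pairs C B
claimᶜ-decreases C B {a} {b} ab = unclaimed-pairs-< {C = C} {B} {(a , b) ∷ C} {B}
  (λ (u≢v , ¬Cuv , ¬Buv) → u≢v , ¬Cuv ∘ Adj-there {e = a , b} C , ¬Buv) ab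
  (λ (_ , ¬Cab , _) → ¬Cab (Adj-here C (inj₁ (refl , refl))))

claimᴮ-decreases : (C B : Graph n) {a b : Fin n} → Unclaimed C B a b →
                   unclaimed-pairs C ((a , b) ∷ B) < unclaimed-pairs C B
claimᴮ-decreases C B {a} {b} ab = unclaimed-pairs-< {C = C} {B} {C} {(a , b) ∷ B}
  (λ (u≢v , ¬Cuv , ¬Buv) → u≢v , ¬Cuv , ¬Buv ∘ Adj-there {e = a , b} B) ab
  (λ (_ , _ , ¬Bab) → ¬Bab (Adj-here B (inj₁ (refl , refl))))

module Endgame {n s : ℕ} where
  mutual
    endgameᶜ′ : ∀ fuel (C B : Graph n) → unclaimed-pairs C B < fuel → s ≤ triangles C → CWins s C B
    endgameᶜ′ (suc fuel) C B bound secured = play (HasMove? C B)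
      where
      play : Dec (∃[ u ] ∃[ v ] LegalC C B u v) → CWins s C B
      play (no  over) = c-end over secured
      play (yes (u , v , legal@(uv , _))) =
        c-move u v legal (endgameᴮ′ fuel ((u , v) ∷ C) B
          (<-≤-trans (claimᶜ-decreases C B uv) (≤-pred bound))
          (≤-trans secured (triangles-⊑ {G = C} {(u , v) ∷ C} (⊑-step ⊑-refl))))

    endgameᴮ′ : ∀ fuel (C B : Graph n) → unclaimed-pairs C B < fuel → s ≤ triangles C → BWins s C B
    endgameᴮ′ (suc fuel) C B bound secured = play (HasMove? C B)
      where
      play : Dec (∃[ u ] ∃[ v ] LegalC C B u v) → BWins s C B
      play (no  over) = b-end over secured
      play (yes move) = b-move (λ over → over move) λ u v uv →
        endgameᶜ′ fuel C ((u , v) ∷ B) (<-≤-trans (claimᴮ-decreases C B uv) (≤-pred bound)) secured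

  endgameᶜ : (C B : Graph n) → s ≤ triangles C → CWins s C B
  endgameᶜ C B = endgameᶜ′ _ C B ≤-refl

  endgameᴮ : (C B : Graph n) → s ≤ triangles C → BWins s C B
  endgameᴮ C B = endgameᴮ′ _ C B ≤-refl

open Endgame

-- Constructor's strategy

Avoids : Graph n → List (Fin n) → Fin n → Set
Avoids B S v = All (λ w → w ≢ v × ¬ Adj B w v) S

Fresh : ℕ → Graph n → Graph n → List (Fin n) → Fin n → Set
Fresh D C B S v = deg C v ≡ 0 × deg B v ≤ D × Avoids B S v

touchesᵇ : Graph n → List (Fin n) → Fin n → Bool
touchesᵇ B S v = any (λ w → ⌊ w ≟ v ⌋ ∨ adjᵇ B w v) S

¬touches⇒Avoids : (B : Graph n) (S : List (Fin n)) {v : Fin n} → ¬ T (touchesᵇ B S v) → Avoids B S v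
¬touches⇒Avoids B S ¬t = All.map split (¬Any⇒All¬ S (¬t ∘ any⁺ _))
  where
  split : ∀ {w v} → ¬ T (⌊ w ≟ v ⌋ ∨ adjᵇ B w v) → w ≢ v × ¬ Adj B w v
  split {w} {v} ¬wv = (λ w≡v → ¬wv (Equivalence.from T-∨ (inj₁ (fromWitness {a? = w ≟ v} w≡v)))) ,
                      (λ adj → ¬wv (Equivalence.from T-∨ (inj₂ adj)))

-- The price of avoiding S: each w in S excludes itself and its Blocker-neighbours.
avoidance-cost : Graph n → List (Fin n) → ℕ
avoidance-cost B S = sum (map (suc ∘ deg B) S)

count-touches : (B : Graph n) (S : List (Fin n)) → count (touchesᵇ B S) ≤ avoidance-cost B S
count-touches {n} B []      = ≤-reflexive (∑-≡0 {n} λ _ → refl)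
count-touches     B (w ∷ S) =
  ≤-trans (count-∨ (λ v → ⌊ w ≟ v ⌋ ∨ adjᵇ B w v) (touchesᵇ B S))
    (+-mono-≤ (≤-trans (count-∨ (λ v → ⌊ w ≟ v ⌋) (adjᵇ B w))
                       (+-mono-≤ (≤-reflexive (∑-δ w)) (count-adj≤deg B w)))
              (count-touches B S))

unfitᵇ : ℕ → Graph n → Graph n → List (Fin n) → Fin n → Bool
unfitᵇ D C B S v = usedᵇ C v ∨ highᵇ D B v ∨ touchesᵇ B S v

fit⇒Fresh : ∀ D (C B : Graph n) S {v} → ¬ T (unfitᵇ D C B S v) → Fresh D C B S v
fit⇒Fresh D C B S {v} fit = isolated , low , ¬touches⇒Avoids B S (fit ∘ right {usedᵇ C v} ∘ right {highᵇ D B v})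
  where
  right : ∀ {x y} → T y → T (x ∨ y)
  right {x} = Equivalence.from (T-∨ {x}) ∘ inj₂
  isolated : deg C v ≡ 0
  isolated = n≤0⇒n≡0 (≮⇒≥ λ 0<deg → fit (Equivalence.from T-∨ (inj₁ (<⇒<ᵇ 0<deg))))
  low : deg B v ≤ D
  low = ≮⇒≥ λ D<deg → fit (right {usedᵇ C v} (Equivalence.from (T-∨ {highᵇ D B v}) (inj₁ (<⇒<ᵇ D<deg))))

count-unfit : ∀ D (C B : Graph n) S → count (unfitᵇ D C B S) ≤ used C + (count (highᵇ D B) + avoidance-cost B S)
count-unfit D C B S =
  ≤-trans (count-∨ (usedᵇ C) _)
    (+-monoʳ-≤ (used C) (≤-trans (count-∨ (highᵇ D B) _) (+-monoʳ-≤ (count (highᵇ D B)) (count-touches B S))))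

search : (D : ℕ) (C B : Graph n) (S : List (Fin n)) →
         (∃[ v ] Fresh D C B S v) ⊎ n ≤ used C + (count (highᵇ D B) + avoidance-cost B S)
search D C B S with any? (λ v → ¬? (T? (unfitᵇ D C B S v)))
... | yes (v , fit) = inj₁ (v , fit⇒Fresh D C B S fit)
... | no  none      = inj₂ (≤-trans (≤-reflexive (sym (count-all _ all-unfit))) (count-unfit D C B S))
  where
  all-unfit : ∀ v → T (unfitᵇ D C B S v)
  all-unfit v = decidable-stable (T? _) (λ fit → none (v , fit))

avoidance-cost-≤ : ∀ {d} (B : Graph n) (S : List (Fin n)) → All (λ w → deg B w ≤ d) S →
                   avoidance-cost B S ≤ length S * suc d
avoidance-cost-≤ B []      []         = z≤n
avoidance-cost-≤ B (w ∷ S) (dw ∷ dS) = +-mono-≤ (s≤s dw) (avoidance-cost-≤ B S dS)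

≡-≤-trans : ∀ {a b c} → a ≡ b → b ≤ c → a ≤ c
≡-≤-trans refl b≤c = b≤c

≡suc⇒1≤ : ∀ {a b} → a ≡ suc b → 1 ≤ a
≡suc⇒1≤ refl = s≤s z≤n

-- The accounting of the strategy, with T rounds, W restarts, u used vertices, h vertices of
-- Blocker-degree > D, x further excluded vertices and b Blocker edges.
ScoreBound : (n D K s : ℕ) → Set
ScoreBound n D K s = ∀ T W u h x b → n ≤ u + (h + x) → u ≤ 3 * T + 4 + 2 * W → suc D * h ≤ 2 * b →
                     W * (K ∸ (D + 4)) ≤ 2 * b → 2 * b ≤ 3 * n → x ≤ 3 * suc (suc K) → s ≤ T

module Strategy (n D K s : ℕ) (D≤K : D ≤ K) (score-bound : ScoreBound n D K s) where

  -- A port is created with Blocker-degree at most D + 3.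
  excess : Graph n → Fin n → ℕ
  excess B v = deg B v ∸ (D + 4)

  restart-cost : ℕ
  restart-cost = K ∸ (D + 4)

  -- Blocker's edges pay for the excess degrees at the ports and for every restart.
  record Balanced (W : ℕ) (B : Graph n) (p₁ p₂ : Fin n) : Set where
    constructor balanced-by
    field paid : W * restart-cost + (excess B p₁ + excess B p₂) ≤ 2 * length B

  excess-∷ : (B : Graph n) {u v : Fin n} (w : Fin n) → u ≢ v → excess ((u , v) ∷ B) w ≤ suc (excess B w)
  excess-∷ B {u} {v} w u≢v = m≤n+o⇒m∸n≤o (deg ((u , v) ∷ B) w) (D + 4) (begin
    deg ((u , v) ∷ B) w          ≤⟨ deg-∷-≤ B w u≢v ⟩
    suc (deg B w)                ≤⟨ s≤s (m≤n+m∸n (deg B w) (D + 4)) ⟩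
    suc (D + 4 + excess B w)     ≡⟨ sym (+-suc (D + 4) (excess B w)) ⟩
    D + 4 + suc (excess B w)     ∎)
    where open ≤-Reasoning

  Balanced-∷ : ∀ {W} (B : Graph n) {u v p₁ p₂ : Fin n} → u ≢ v → Balanced W B p₁ p₂ → Balanced W ((u , v) ∷ B) p₁ p₂
  Balanced-∷ {W} B {u} {v} {p₁} {p₂} u≢v (balanced-by balanced) = balanced-by $ begin
    W * restart-cost + (excess ((u , v) ∷ B) p₁ + excess ((u , v) ∷ B) p₂)
      ≤⟨ +-monoʳ-≤ (W * restart-cost) (+-mono-≤ (excess-∷ B p₁ u≢v) (excess-∷ B p₂ u≢v)) ⟩
    W * restart-cost + (suc (excess B p₁) + suc (excess B p₂))
      ≡⟨ two-more (W * restart-cost) (excess B p₁) (excess B p₂) ⟩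
    2 + (W * restart-cost + (excess B p₁ + excess B p₂))
      ≤⟨ +-monoʳ-≤ 2 balanced ⟩
    2 + 2 * length B
      ≡⟨ sym (*-suc 2 (length B)) ⟩
    2 * length ((u , v) ∷ B) ∎
    where
    open ≤-Reasoning
    two-more : ∀ w a b → w + (suc a + suc b) ≡ 2 + (w + (a + b))
    two-more = solve-∀

  Balanced-swap : ∀ {W} {B : Graph n} {p₁ p₂} → Balanced W B p₁ p₂ → Balanced W B p₂ p₁
  Balanced-swap {W} {B} {p₁} {p₂} (balanced-by balanced) =
    balanced-by (subst (λ Φ → W * restart-cost + Φ ≤ 2 * length B) (+-comm (excess B p₁) (excess B p₂)) balanced)

  Balanced-replace : ∀ {W} {B : Graph n} {p₁ p₂ r} → deg B r ≤ D + 4 → Balanced W B p₁ p₂ → Balanced W B r p₂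
  Balanced-replace {W} {B} {p₁} {p₂} {r} low (balanced-by balanced) =
    balanced-by (≤-trans (+-monoʳ-≤ (W * restart-cost) (+-monoˡ-≤ (excess B p₂) excess≤)) balanced)
    where
    excess≤ : excess B r ≤ excess B p₁
    excess≤ = subst (_≤ excess B p₁) (sym (m≤n⇒m∸n≡0 low)) z≤n

  Balanced-restart : ∀ {W} {B : Graph n} {p₁ p₂ y₁ y₂} → restart-cost ≤ excess B p₁ + excess B p₂ →
                     deg B y₁ ≤ D + 4 → deg B y₂ ≤ D + 4 → Balanced W B p₁ p₂ → Balanced (suc W) B y₁ y₂
  Balanced-restart {W} {B} {p₁} {p₂} {y₁} {y₂} paid low₁ low₂ (balanced-by balanced) = balanced-by $ begin
    suc W * restart-cost + (excess B y₁ + excess B y₂)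
      ≡⟨ cong₂ (λ e₁ e₂ → suc W * restart-cost + (e₁ + e₂)) (m≤n⇒m∸n≡0 low₁) (m≤n⇒m∸n≡0 low₂) ⟩
    suc W * restart-cost + 0                           ≡⟨ shuffle W restart-cost ⟩
    W * restart-cost + restart-cost                    ≤⟨ +-monoʳ-≤ (W * restart-cost) paid ⟩
    W * restart-cost + (excess B p₁ + excess B p₂)     ≤⟨ balanced ⟩
    2 * length B                                       ∎
    where
    open ≤-Reasoning
    shuffle : ∀ w c → suc w * c + 0 ≡ w * c + c
    shuffle = solve-∀

  -- Every round uses at most three new vertices, the opening edge and every restart two.
  record Invariant (C B : Graph n) : Set where
    field
      port₁ port₂     : Fin n
      rounds restarts : ℕ
      subcubic        : Subcubic C
      ports-distinct  : port₁ ≢ port₂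
      port₁-leaf      : deg C port₁ ≡ 1
      port₂-leaf      : deg C port₂ ≡ 1
      blocker-behind  : length B ≤ length C
      balanced        : Balanced restarts B port₁ port₂
      used-bound      : used C ≤ 3 * rounds + 2 + 2 * restarts
      secured         : rounds ≤ triangles C

  open Invariant

  length-⊑ : ∀ {G H : Graph n} → G ⊑ H → length G ≤ length H
  length-⊑ = ⊑-lift _≤_ ≤-refl ≤-trans length (λ _ G → n≤1+n (length G))

  give-up : ∀ {C B : Graph n} (C′ B′ : Graph n) (I : Invariant C B) (S : List (Fin n)) →
            C ⊑ C′ → B ⊑ B′ → length B′ ≤ length C′ → Subcubic C′ →
            used C′ ≤ 3 * rounds I + 4 + 2 * restarts I → length S ≤ 3 → All (λ w → deg B′ w ≤ suc K) S →
            n ≤ used C′ + (count (highᵇ D B′) + avoidance-cost B′ S) → s ≤ triangles C′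
  give-up {C} {B} C′ B′ I S C⊑C′ B⊑B′ B′≤C′ subcubic′ used′ |S|≤3 S-low exhausted =
    ≤-trans (score-bound (rounds I) (restarts I) (used C′) (count (highᵇ D B′)) (avoidance-cost B′ S) (length B′)
               exhausted used′ (high-count D B′) restarts-paid
               (≤-trans (*-monoʳ-≤ 2 B′≤C′) (subcubic⇒edges C′ subcubic′))
               (≤-trans (avoidance-cost-≤ B′ S S-low) (*-monoˡ-≤ (suc (suc K)) |S|≤3)))
            (≤-trans (secured I) (triangles-⊑ C⊑C′))
    where
    restarts-paid : restarts I * restart-cost ≤ 2 * length B′
    restarts-paid = ≤-trans (m≤m+n _ _) (≤-trans (Balanced.paid (balanced I)) (*-monoʳ-≤ 2 (length-⊑ B⊑B′)))

  Invariant-∷ᴮ : ∀ {C B : Graph n} {u v} → Invariant C B → u ≢ v → length B < length C → Invariant C ((u , v) ∷ B)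
  Invariant-∷ᴮ {B = B} I u≢v B<C = record
    { port₁ = port₁ I ; port₂ = port₂ I ; rounds = rounds I ; restarts = restarts I
    ; subcubic = subcubic I ; ports-distinct = ports-distinct I ; port₁-leaf = port₁-leaf I ; port₂-leaf = port₂-leaf I
    ; blocker-behind = B<C ; balanced = Balanced-∷ B u≢v (balanced I)
    ; used-bound = used-bound I ; secured = secured I }

  complete-round : ∀ {C B C′ B′ : Graph n} (I : Invariant C B) {l₁ l₂ a b c : Fin n} →
    C ⊑ C′ → Subcubic C′ → l₁ ≢ l₂ → deg C′ l₁ ≡ 1 → deg C′ l₂ ≡ 1 → length B′ ≤ length C′ →
    Balanced (restarts I) B′ l₁ l₂ → used C′ ≤ used C + 3 →
    a ≢ b → b ≢ c → a ≢ c → Triangle C′ a b c → deg C a ≤ 1 → deg C b ≤ 1 → deg C c ≤ 1 → Invariant C′ B′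
  complete-round I {l₁} {l₂} C⊑C′ subcubic′ l₁≢l₂ l₁-leaf l₂-leaf B′≤C′ balanced′ used′ a≢b b≢c a≢c abc da db dc = record
    { port₁ = l₁ ; port₂ = l₂ ; rounds = suc (rounds I) ; restarts = restarts I
    ; subcubic = subcubic′ ; ports-distinct = l₁≢l₂ ; port₁-leaf = l₁-leaf ; port₂-leaf = l₂-leaf
    ; blocker-behind = B′≤C′ ; balanced = balanced′
    ; used-bound = ≤-trans used′ (≤-trans (+-monoˡ-≤ 3 (used-bound I)) (≤-reflexive (three-more (rounds I) (restarts I))))
    ; secured = ≤-trans (s≤s (secured I)) (new-triangle C⊑C′ a≢b b≢c a≢c abc da db dc) }
    where
    three-more : ∀ t w → 3 * t + 2 + 2 * w + 3 ≡ 3 * suc t + 2 + 2 * w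
    three-more = solve-∀

  used-bound′ : ∀ {C B : Graph n} (I : Invariant C B) → used C ≤ 3 * rounds I + 4 + 2 * restarts I
  used-bound′ I = ≤-trans (used-bound I) (+-monoˡ-≤ (2 * restarts I) (+-monoʳ-≤ (3 * rounds I) (s≤s (s≤s z≤n))))

  slack : ∀ k → k ≤ 4 → k + D ≤ D + 4
  slack k k≤4 = ≤-trans (≤-reflexive (+-comm k D)) (+-monoʳ-≤ D k≤4)

  Next : ℕ → Set
  Next f = ∀ C B → Invariant C B → n ≤ used C + f → length B < length C → BWins s C B

  -- Constructor holds xq and both xp, qp are free; she claims xr for a fresh r, then qr closes the
  -- triangle xqr unless Blocker took it, in which case xp threatens both pq and pr.
  module Threats (f : ℕ) (next : Next f) {C B : Graph n} (I : Invariant C B) (fuel : n ≤ used C + suc f)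
    {p p′ : Fin n} (p-leaf : deg C p ≡ 1) (p′-leaf : deg C p′ ≡ 1) (p≢p′ : p ≢ p′)
    (bal : Balanced (restarts I) B p p′) (p-low : deg B p ≤ K)
    {x q : Fin n} (x-isolated : deg C x ≡ 0) (x-low : deg B x ≤ D) (q-isolated : deg C q ≡ 0) (q-low : deg B q ≤ D)
    (x≢q : x ≢ q) {u₁ v₁ : Fin n} (u₁≢v₁ : u₁ ≢ v₁)
    (xp-free : Unclaimed ((x , q) ∷ C) ((u₁ , v₁) ∷ B) x p) (qp-free : Unclaimed ((x , q) ∷ C) ((u₁ , v₁) ∷ B) q p) where

    C₁ B₁ : Graph n
    C₁ = (x , q) ∷ C
    B₁ = (u₁ , v₁) ∷ B

    x≢p : x ≢ p
    x≢p = isolated⇒≢ C x-isolated (≡suc⇒1≤ p-leaf)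
    x≢p′ : x ≢ p′
    x≢p′ = isolated⇒≢ C x-isolated (≡suc⇒1≤ p′-leaf)
    q≢p : q ≢ p
    q≢p = isolated⇒≢ C q-isolated (≡suc⇒1≤ p-leaf)
    q≢p′ : q ≢ p′
    q≢p′ = isolated⇒≢ C q-isolated (≡suc⇒1≤ p′-leaf)

    deg₁-x : deg C₁ x ≡ 1
    deg₁-x = trans (deg-∷-fst C x≢q) (cong suc x-isolated)
    deg₁-q : deg C₁ q ≡ 1
    deg₁-q = trans (deg-∷-snd C x≢q) (cong suc q-isolated)
    deg₁-p : deg C₁ p ≡ 1
    deg₁-p = trans (deg-∷-≢ C (x≢p ∘ sym) (q≢p ∘ sym)) p-leaf
    deg₁-p′ : deg C₁ p′ ≡ 1
    deg₁-p′ = trans (deg-∷-≢ C (x≢p′ ∘ sym) (q≢p′ ∘ sym)) p′-leaf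

    subcubic₁ : Subcubic C₁
    subcubic₁ = Subcubic-∷ C (subcubic I) (≡-≤-trans x-isolated z≤n) (≡-≤-trans q-isolated z≤n) x≢q

    deg-B₁ : ∀ w → deg B₁ w ≤ suc (deg B w)
    deg-B₁ w = deg-∷-≤ B w u₁≢v₁

    fuel-after : ∀ C′ → C₁ ⊑ C′ → n ≤ used C′ + f
    fuel-after C′ C₁⊑C′ = ≤-trans fuel (≤-trans (≤-reflexive (+-suc (used C) f))
                         (+-monoˡ-≤ f (≤-trans (used-∷-isolated C x q x-isolated) (used-⊑ C₁⊑C′))))

    used₁ : used C₁ ≤ used C + 2
    used₁ = used-∷-+2 C x q

    module ThirdVertex {r : Fin n} (r-isolated : deg C₁ r ≡ 0) (r-low : deg B₁ r ≤ D)
                 (x≢r : x ≢ r) (¬xr : ¬ Adj B₁ x r) (q≢r : q ≢ r) (¬qr : ¬ Adj B₁ q r)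
                 (p≢r : p ≢ r) (¬pr : ¬ Adj B₁ p r) where

      C₂ : Graph n
      C₂ = (x , r) ∷ C₁

      r≢p′ : r ≢ p′
      r≢p′ = isolated⇒≢ C₁ r-isolated (≡suc⇒1≤ deg₁-p′)

      r-low₀ : deg C r ≤ 1
      r-low₀ = ≤-trans (deg-⊑ {G = C} {C₁} (⊑-step ⊑-refl)) (≡-≤-trans r-isolated z≤n)

      ¬C₁-r : ∀ w → ¬ Adj C₁ w r
      ¬C₁-r w = isolated⇒¬Adj C₁ r-isolated ∘ Adj-sym C₁

      legal-xr : LegalC C₁ B₁ x r
      legal-xr = legal-move C₁ B₁ (x≢r , ¬C₁-r x , ¬xr) subcubic₁ (≡-≤-trans deg₁-x (s≤s z≤n)) (≡-≤-trans r-isolated z≤n)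

      subcubic₂ : Subcubic C₂
      subcubic₂ = Subcubic-∷ C₁ subcubic₁ (≡-≤-trans deg₁-x (s≤s z≤n)) (≡-≤-trans r-isolated z≤n) x≢r

      deg₂-x : deg C₂ x ≡ 2
      deg₂-x = trans (deg-∷-fst C₁ x≢r) (cong suc deg₁-x)
      deg₂-r : deg C₂ r ≡ 1
      deg₂-r = trans (deg-∷-snd C₁ x≢r) (cong suc r-isolated)
      deg₂-q : deg C₂ q ≡ 1
      deg₂-q = trans (deg-∷-≢ C₁ (x≢q ∘ sym) q≢r) deg₁-q
      deg₂-p : deg C₂ p ≡ 1
      deg₂-p = trans (deg-∷-≢ C₁ (x≢p ∘ sym) p≢r) deg₁-p
      deg₂-p′ : deg C₂ p′ ≡ 1
      deg₂-p′ = trans (deg-∷-≢ C₁ (x≢p′ ∘ sym) (r≢p′ ∘ sym)) deg₁-p′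

      used₂ : used C₂ ≤ used C + 3
      used₂ = ≤-trans (used-∷-+1 C₁ r (≡suc⇒1≤ deg₁-x)) (≤-trans (+-monoˡ-≤ 1 used₁) (≤-reflexive (+-assoc (used C) 2 1)))

      xp-free₂ : Unclaimed C₂ B₁ x p
      xp-free₂ = Unclaimed-∷ᶜ C₁ B₁ (x , r) xp-free (¬Joins-snd (x≢p ∘ sym) p≢r)

      qp-free₂ : Unclaimed C₂ B₁ q p
      qp-free₂ = Unclaimed-∷ᶜ C₁ B₁ (x , r) qp-free (¬Joins-fst (x≢q ∘ sym) q≢r)

      legal-xp₂ : LegalC C₂ B₁ x p
      legal-xp₂ = legal-move C₂ B₁ xp-free₂ subcubic₂ (≡-≤-trans deg₂-x ≤-refl) (≡-≤-trans deg₂-p (s≤s z≤n))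

      xq∈ : ∀ G → C₁ ⊑ G → Adj G x q
      xq∈ G C₁⊑G = Adj-⊑ C₁⊑G (Adj-∷-head C x q)

      xr∈ : ∀ G → C₂ ⊑ G → Adj G x r
      xr∈ G C₂⊑G = Adj-⊑ C₂⊑G (Adj-∷-head C₁ x r)

      module BlockerReply {u₂ v₂ : Fin n} (uv₂ : Unclaimed C₂ B₁ u₂ v₂) where

        B₂ : Graph n
        B₂ = (u₂ , v₂) ∷ B₁

        balanced₂ : Balanced (restarts I) B₂ p p′
        balanced₂ = Balanced-∷ B₁ (proj₁ uv₂) (Balanced-∷ B u₁≢v₁ bal)

        close-qr : ¬ Adj B₂ q r → CWins s C₂ B₂
        close-qr ¬qr₂ = c-move q r legal-qr
          (next C₃ B₂ I′ (fuel-after C₃ (⊑-step (⊑-step ⊑-refl))) (s≤s (s≤s (s≤s (blocker-behind I)))))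
          where
          C₃ : Graph n
          C₃ = (q , r) ∷ C₂
          legal-qr : LegalC C₂ B₂ q r
          legal-qr = legal-move C₂ B₂ (Unclaimed-∷ᶜ C₁ B₂ (x , r) (q≢r , ¬C₁-r q , ¬qr₂) (¬Joins-fst (x≢q ∘ sym) q≢r))
                       subcubic₂ (≡-≤-trans deg₂-q (s≤s z≤n)) (≡-≤-trans deg₂-r (s≤s z≤n))
          I′ : Invariant C₃ B₂
          I′ = complete-round I (⊑-step (⊑-step (⊑-step ⊑-refl)))
                 (Subcubic-∷ C₂ subcubic₂ (≡-≤-trans deg₂-q (s≤s z≤n)) (≡-≤-trans deg₂-r (s≤s z≤n)) q≢r) p≢p′
                 (trans (deg-∷-≢ C₂ (q≢p ∘ sym) p≢r) deg₂-p) (trans (deg-∷-≢ C₂ (q≢p′ ∘ sym) (r≢p′ ∘ sym)) deg₂-p′)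
                 (s≤s (s≤s (m≤n⇒m≤1+n (blocker-behind I)))) balanced₂
                 (≤-trans (used-∷-+0 C₂ (≡suc⇒1≤ deg₂-q) (≡suc⇒1≤ deg₂-r)) used₂)
                 x≢q q≢r x≢r (xq∈ C₃ (⊑-step (⊑-step ⊑-refl)) , Adj-∷-head C₂ q r , xr∈ C₃ (⊑-step ⊑-refl))
                 (≡-≤-trans x-isolated z≤n) (≡-≤-trans q-isolated z≤n) r-low₀

        module DoubleThreat (qr₂ : Adj B₂ q r) where

          C₃ : Graph n
          C₃ = (x , p) ∷ C₂

          took-qr : Joins (u₂ , v₂) q r
          took-qr with Adj-∷⁻ {e = u₂ , v₂} B₁ qr₂
          ... | inj₁ j   = j
          ... | inj₂ qr₁ = ⊥-elim (¬qr qr₁)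

          not-xp : ¬ Joins (u₂ , v₂) x p
          not-xp j with Joins-unique took-qr j
          ... | inj₁ (q≡x , _) = x≢q (sym q≡x)
          ... | inj₂ (q≡p , _) = q≢p q≡p

          not-qp : ¬ Joins (u₂ , v₂) q p
          not-qp j with Joins-unique took-qr j
          ... | inj₁ (_ , r≡p) = p≢r (sym r≡p)
          ... | inj₂ (q≡p , _) = q≢p q≡p

          legal-xp : LegalC C₂ B₂ x p
          legal-xp = legal-move C₂ B₂ (Unclaimed-∷ᴮ C₂ B₁ (u₂ , v₂) xp-free₂ not-xp)
                       subcubic₂ (≡-≤-trans deg₂-x ≤-refl) (≡-≤-trans deg₂-p (s≤s z≤n))

          subcubic₃ : Subcubic C₃
          subcubic₃ = Subcubic-∷ C₂ subcubic₂ (≡-≤-trans deg₂-x ≤-refl) (≡-≤-trans deg₂-p (s≤s z≤n)) x≢p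

          deg₃-p : deg C₃ p ≡ 2
          deg₃-p = trans (deg-∷-snd C₂ x≢p) (cong suc deg₂-p)
          deg₃-q : deg C₃ q ≡ 1
          deg₃-q = trans (deg-∷-≢ C₂ (x≢q ∘ sym) q≢p) deg₂-q
          deg₃-r : deg C₃ r ≡ 1
          deg₃-r = trans (deg-∷-≢ C₂ (x≢r ∘ sym) (p≢r ∘ sym)) deg₂-r
          deg₃-p′ : deg C₃ p′ ≡ 1
          deg₃-p′ = trans (deg-∷-≢ C₂ (x≢p′ ∘ sym) (p≢p′ ∘ sym)) deg₂-p′

          pq-free₃ : Unclaimed C₃ B₂ p q
          pq-free₃ = Unclaimed-sym C₃ B₂ (Unclaimed-∷ᶜ C₂ B₂ (x , p)
                       (Unclaimed-∷ᴮ C₂ B₁ (u₂ , v₂) qp-free₂ not-qp) (¬Joins-fst (x≢q ∘ sym) q≢p))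

          legal-pq : LegalC C₃ B₂ p q
          legal-pq = legal-move C₃ B₂ pq-free₃ subcubic₃ (≡-≤-trans deg₃-p ≤-refl) (≡-≤-trans deg₃-q (s≤s z≤n))

          used₃ : used C₃ ≤ used C + 3
          used₃ = ≤-trans (used-∷-+0 C₂ (≡suc⇒1≤ deg₂-x) (≡suc⇒1≤ deg₂-p)) used₂

          xp∈ : ∀ G → C₃ ⊑ G → Adj G x p
          xp∈ G C₃⊑G = Adj-⊑ C₃⊑G (Adj-∷-head C₂ x p)

          deg-B₂ : ∀ w → deg B₂ w ≤ 2 + deg B w
          deg-B₂ w = ≤-trans (deg-∷-≤ B₁ w (proj₁ uv₂)) (s≤s (deg-B₁ w))

          module ThirdReply {u₃ v₃ : Fin n} (uv₃ : Unclaimed C₃ B₂ u₃ v₃) where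

            B₃ : Graph n
            B₃ = (u₃ , v₃) ∷ B₂

            close-pq : ¬ Adj B₃ p q → CWins s C₃ B₃
            close-pq ¬pq₃ = c-move p q legal
              (next C₄ B₃ I′ (fuel-after C₄ (⊑-step (⊑-step (⊑-step ⊑-refl)))) (s≤s (s≤s (s≤s (s≤s (blocker-behind I))))))
              where
              C₄ : Graph n
              C₄ = (p , q) ∷ C₃
              legal : LegalC C₃ B₃ p q
              legal = legal-move C₃ B₃ (proj₁ pq-free₃ , proj₁ (proj₂ pq-free₃) , ¬pq₃)
                        subcubic₃ (≡-≤-trans deg₃-p ≤-refl) (≡-≤-trans deg₃-q (s≤s z≤n))
              r-low₃ : deg B₃ r ≤ D + 4
              r-low₃ = ≤-trans (deg-∷-≤ B₂ r (proj₁ uv₃))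
                         (≤-trans (s≤s (deg-∷-≤ B₁ r (proj₁ uv₂))) (≤-trans (s≤s (s≤s r-low)) (slack 2 (s≤s (s≤s z≤n)))))
              I′ : Invariant C₄ B₃
              I′ = complete-round I (⊑-step (⊑-step (⊑-step (⊑-step ⊑-refl))))
                     (Subcubic-∷ C₃ subcubic₃ (≡-≤-trans deg₃-p ≤-refl) (≡-≤-trans deg₃-q (s≤s z≤n)) (q≢p ∘ sym)) r≢p′
                     (trans (deg-∷-≢ C₃ (p≢r ∘ sym) (q≢r ∘ sym)) deg₃-r) (trans (deg-∷-≢ C₃ (p≢p′ ∘ sym) (q≢p′ ∘ sym)) deg₃-p′)
                     (s≤s (s≤s (s≤s (m≤n⇒m≤1+n (blocker-behind I)))))
                     (Balanced-replace r-low₃ (Balanced-∷ B₂ (proj₁ uv₃) balanced₂))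
                     (≤-trans (used-∷-+0 C₃ (≡suc⇒1≤ deg₃-p) (≡suc⇒1≤ deg₃-q)) used₃)
                     x≢p (q≢p ∘ sym) x≢q
                     (xp∈ C₄ (⊑-step ⊑-refl) , Adj-∷-head C₃ p q , xq∈ C₄ (⊑-step (⊑-step (⊑-step ⊑-refl))))
                     (≡-≤-trans x-isolated z≤n) (≡-≤-trans p-leaf ≤-refl) (≡-≤-trans q-isolated z≤n)

            close-pr : Adj B₃ p q → CWins s C₃ B₃
            close-pr pq₃ = c-move p r legal
              (next C₄ B₃ I′ (fuel-after C₄ (⊑-step (⊑-step (⊑-step ⊑-refl)))) (s≤s (s≤s (s≤s (s≤s (blocker-behind I))))))
              where
              C₄ : Graph n
              C₄ = (p , r) ∷ C₃
              took-pq : Joins (u₃ , v₃) p q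
              took-pq with Adj-∷⁻ {e = u₃ , v₃} B₂ pq₃
              ... | inj₁ j   = j
              ... | inj₂ pq₂ = ⊥-elim (proj₂ (proj₂ pq-free₃) pq₂)
              ¬B₃-pr : ¬ Adj B₃ p r
              ¬B₃-pr pr₃ with Adj-∷⁻ {e = u₃ , v₃} B₂ pr₃
              ... | inj₁ j with Joins-unique took-pq j
              ...   | inj₁ (_ , q≡r) = q≢r q≡r
              ...   | inj₂ (p≡r , _) = p≢r p≡r
              ¬B₃-pr pr₃ | inj₂ pr₂ with Adj-∷⁻ {e = u₂ , v₂} B₁ pr₂
              ... | inj₁ j with Joins-unique took-qr j
              ...   | inj₁ (q≡p , _) = q≢p q≡p
              ...   | inj₂ (q≡r , _) = q≢r q≡r
              ¬B₃-pr pr₃ | inj₂ pr₂ | inj₂ pr₁ = ¬pr pr₁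
              pr-free₃ : Unclaimed C₃ B₃ p r
              pr-free₃ = Unclaimed-∷ᶜ C₂ B₃ (x , p)
                           (Unclaimed-∷ᶜ C₁ B₃ (x , r) (p≢r , ¬C₁-r p , ¬B₃-pr) (¬Joins-fst (x≢p ∘ sym) p≢r))
                           (¬Joins-snd (x≢r ∘ sym) (p≢r ∘ sym))
              legal : LegalC C₃ B₃ p r
              legal = legal-move C₃ B₃ pr-free₃ subcubic₃ (≡-≤-trans deg₃-p ≤-refl) (≡-≤-trans deg₃-r (s≤s z≤n))
              q-low₃ : deg B₃ q ≤ D + 4
              q-low₃ = ≤-trans (deg-∷-≤ B₂ q (proj₁ uv₃)) (≤-trans (s≤s (deg-B₂ q)) (≤-trans (s≤s (s≤s (s≤s q-low)))
                         (slack 3 (s≤s (s≤s (s≤s z≤n))))))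
              I′ : Invariant C₄ B₃
              I′ = complete-round I (⊑-step (⊑-step (⊑-step (⊑-step ⊑-refl))))
                     (Subcubic-∷ C₃ subcubic₃ (≡-≤-trans deg₃-p ≤-refl) (≡-≤-trans deg₃-r (s≤s z≤n)) p≢r) q≢p′
                     (trans (deg-∷-≢ C₃ q≢p q≢r) deg₃-q) (trans (deg-∷-≢ C₃ (p≢p′ ∘ sym) (r≢p′ ∘ sym)) deg₃-p′)
                     (s≤s (s≤s (s≤s (m≤n⇒m≤1+n (blocker-behind I)))))
                     (Balanced-replace q-low₃ (Balanced-∷ B₂ (proj₁ uv₃) balanced₂))
                     (≤-trans (used-∷-+0 C₃ (≡suc⇒1≤ deg₃-p) (≡suc⇒1≤ deg₃-r)) used₃)
                     x≢p p≢r x≢r (xp∈ C₄ (⊑-step ⊑-refl) , Adj-∷-head C₃ p r , xr∈ C₄ (⊑-step (⊑-step ⊑-refl)))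
                     (≡-≤-trans x-isolated z≤n) (≡-≤-trans p-leaf ≤-refl) r-low₀

            respond : CWins s C₃ B₃
            respond with T? (adjᵇ B₃ p q)
            ... | no  ¬pq₃ = close-pq ¬pq₃
            ... | yes pq₃  = close-pr pq₃

          play : CWins s C₂ B₂
          play = c-move x p legal-xp
                   (b-move (λ over → over (p , q , legal-pq)) (λ u₃ v₃ uv₃ → ThirdReply.respond uv₃))

        respond : CWins s C₂ B₂
        respond with T? (adjᵇ B₂ q r)
        ... | no  ¬qr₂ = close-qr ¬qr₂
        ... | yes qr₂  = DoubleThreat.play qr₂

      after-xr : BWins s C₂ B₁
      after-xr = b-move (λ over → over (x , p , legal-xp₂)) (λ u₂ v₂ uv₂ → BlockerReply.respond uv₂)

    choose-r : CWins s C₁ B₁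
    choose-r with search D C₁ B₁ (x ∷ q ∷ p ∷ [])
    ... | inj₂ exhausted = endgameᶜ C₁ B₁ (give-up C₁ B₁ I (x ∷ q ∷ p ∷ []) (⊑-step ⊑-refl) (⊑-step ⊑-refl)
            (s≤s (blocker-behind I)) subcubic₁ used₁′ (s≤s (s≤s (s≤s z≤n)))
            (low (≤-trans x-low D≤K) ∷ low (≤-trans q-low D≤K) ∷ low p-low ∷ []) exhausted)
      where
      low : ∀ {w} → deg B w ≤ K → deg B₁ w ≤ suc K
      low w-low = ≤-trans (deg-B₁ _) (s≤s w-low)
      used₁′ : used C₁ ≤ 3 * rounds I + 4 + 2 * restarts I
      used₁′ = ≤-trans used₁ (≤-trans (+-monoˡ-≤ 2 (used-bound I)) (≤-reflexive (two-more (rounds I) (restarts I))))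
        where
        two-more : ∀ t w → 3 * t + 2 + 2 * w + 2 ≡ 3 * t + 4 + 2 * w
        two-more = solve-∀
    ... | inj₁ (r , r-isolated , r-low , (x≢r , ¬xr) ∷ (q≢r , ¬qr) ∷ (p≢r , ¬pr) ∷ []) =
      c-move x r legal-xr after-xr
      where open ThirdVertex r-isolated r-low x≢r ¬xr q≢r ¬qr p≢r ¬pr using (legal-xr; after-xr)

  -- The two fresh vertices x, q of a new round: after Constructor claims xq, Blocker's reply
  -- can spoil the triangle through at most one of the two ports.
  module Round (f : ℕ) (next : Next f) {C B : Graph n} (I : Invariant C B) (fuel : n ≤ used C + suc f)
               (p₁-low : deg B (port₁ I) ≤ K) (p₂-low : deg B (port₂ I) ≤ K) where

    p₁ p₂ : Fin n
    p₁ = port₁ I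
    p₂ = port₂ I

    module Opening {x q : Fin n} (x-isolated : deg C x ≡ 0) (x-low : deg B x ≤ D) (¬p₁x : ¬ Adj B p₁ x) (¬p₂x : ¬ Adj B p₂ x)
                   (q-isolated : deg C q ≡ 0) (q-low : deg B q ≤ D) (x≢q : x ≢ q) (¬xq : ¬ Adj B x q)
                   (¬p₁q : ¬ Adj B p₁ q) (¬p₂q : ¬ Adj B p₂ q) where

      C₁ : Graph n
      C₁ = (x , q) ∷ C

      legal-xq : LegalC C B x q
      legal-xq = legal-move C B (x≢q , isolated⇒¬Adj C x-isolated , ¬xq) (subcubic I)
                   (≡-≤-trans x-isolated z≤n) (≡-≤-trans q-isolated z≤n)

      free : ∀ {v p} → deg C v ≡ 0 → deg C p ≡ 1 → ¬ Adj B p v → ¬ Joins (x , q) v p → Unclaimed C₁ B v p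
      free v-isolated p-leaf ¬pv ¬xq-vp =
        Unclaimed-∷ᶜ C B (x , q)
          (isolated⇒≢ C v-isolated (≡suc⇒1≤ p-leaf) , isolated⇒¬Adj C v-isolated , ¬pv ∘ Adj-sym B) ¬xq-vp

      x≢p₁ : x ≢ p₁
      x≢p₁ = isolated⇒≢ C x-isolated (≡suc⇒1≤ (port₁-leaf I))

      q≢p₁ : q ≢ p₁
      q≢p₁ = isolated⇒≢ C q-isolated (≡suc⇒1≤ (port₁-leaf I))

      legal-xp₁ : LegalC C₁ B x p₁
      legal-xp₁ = legal-move C₁ B
        (free x-isolated (port₁-leaf I) ¬p₁x (¬Joins-snd (x≢p₁ ∘ sym) (q≢p₁ ∘ sym)))
        (Subcubic-∷ C (subcubic I) (≡-≤-trans x-isolated z≤n) (≡-≤-trans q-isolated z≤n) x≢q)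
        (≡-≤-trans (trans (deg-∷-fst C x≢q) (cong suc x-isolated)) (s≤s z≤n))
        (≡-≤-trans (trans (deg-∷-≢ C (x≢p₁ ∘ sym) (q≢p₁ ∘ sym)) (port₁-leaf I)) (s≤s z≤n))

      x≢p₂ : x ≢ p₂
      x≢p₂ = isolated⇒≢ C x-isolated (≡suc⇒1≤ (port₂-leaf I))
      q≢p₂ : q ≢ p₂
      q≢p₂ = isolated⇒≢ C q-isolated (≡suc⇒1≤ (port₂-leaf I))

      module _ {u₁ v₁ : Fin n} (uv₁ : Unclaimed C₁ B u₁ v₁) where

        threats : ∀ {p p′} → deg C p ≡ 1 → deg C p′ ≡ 1 → p ≢ p′ → Balanced (restarts I) B p p′ → deg B p ≤ K →
                  ¬ Adj B p x → ¬ Adj B p q → ¬ Joins (u₁ , v₁) x p → ¬ Joins (u₁ , v₁) q p → CWins s C₁ ((u₁ , v₁) ∷ B)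
        threats p-leaf p′-leaf p≢p′ bal p-low ¬px ¬pq ¬u₁v₁-xp ¬u₁v₁-qp =
          Threats.choose-r f next I fuel p-leaf p′-leaf p≢p′ bal p-low x-isolated x-low q-isolated q-low x≢q (proj₁ uv₁)
            (Unclaimed-∷ᴮ C₁ B (u₁ , v₁) (free x-isolated p-leaf ¬px ¬xq-p) ¬u₁v₁-xp)
            (Unclaimed-∷ᴮ C₁ B (u₁ , v₁) (free q-isolated p-leaf ¬pq ¬xq-p) ¬u₁v₁-qp)
          where
          ¬xq-p : ∀ {v} → ¬ Joins (x , q) v _
          ¬xq-p = ¬Joins-snd (isolated⇒≢ C x-isolated (≡suc⇒1≤ p-leaf) ∘ sym)
                             (isolated⇒≢ C q-isolated (≡suc⇒1≤ p-leaf) ∘ sym)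

        spoilt-once : ∀ {v w} → v ≢ p₂ → Joins (u₁ , v₁) v p₁ → ¬ Joins (u₁ , v₁) w p₂
        spoilt-once v≢p₂ j j′ with Joins-unique j j′
        ... | inj₁ (_ , p₁≡p₂) = ports-distinct I p₁≡p₂
        ... | inj₂ (v≡p₂ , _)  = v≢p₂ v≡p₂

        choose-port : CWins s C₁ ((u₁ , v₁) ∷ B)
        choose-port with Joins? (u₁ , v₁) x p₁ | Joins? (u₁ , v₁) q p₁
        ... | no ¬xp₁ | no ¬qp₁ = threats (port₁-leaf I) (port₂-leaf I) (ports-distinct I) (balanced I) p₁-low
                                    ¬p₁x ¬p₁q ¬xp₁ ¬qp₁
        ... | yes xp₁ | _       = threats (port₂-leaf I) (port₁-leaf I) (ports-distinct I ∘ sym)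
                                    (Balanced-swap (balanced I)) p₂-low
                                    ¬p₂x ¬p₂q (spoilt-once x≢p₂ xp₁) (spoilt-once x≢p₂ xp₁)
        ... | no  _   | yes qp₁ = threats (port₂-leaf I) (port₁-leaf I) (ports-distinct I ∘ sym)
                                    (Balanced-swap (balanced I)) p₂-low
                                    ¬p₂x ¬p₂q (spoilt-once q≢p₂ qp₁) (spoilt-once q≢p₂ qp₁)

      opening : CWins s C B
      opening = c-move x q legal-xq (b-move (λ over → over (x , p₁ , legal-xp₁)) (λ u₁ v₁ uv₁ → choose-port uv₁))

    play : CWins s C B
    play with search D C B (p₁ ∷ p₂ ∷ [])
    ... | inj₂ exhausted = endgameᶜ C B (give-up C B I (p₁ ∷ p₂ ∷ []) ⊑-refl ⊑-refl (blocker-behind I) (subcubic I)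
                             (used-bound′ I) (s≤s (s≤s z≤n)) (m≤n⇒m≤1+n p₁-low ∷ m≤n⇒m≤1+n p₂-low ∷ []) exhausted)
    ... | inj₁ (x , x-isolated , x-low , (_ , ¬p₁x) ∷ (_ , ¬p₂x) ∷ []) with search D C B (x ∷ p₁ ∷ p₂ ∷ [])
    ...   | inj₂ exhausted = endgameᶜ C B (give-up C B I (x ∷ p₁ ∷ p₂ ∷ []) ⊑-refl ⊑-refl (blocker-behind I) (subcubic I)
                               (used-bound′ I) (s≤s (s≤s (s≤s z≤n)))
                               (m≤n⇒m≤1+n (≤-trans x-low D≤K) ∷ m≤n⇒m≤1+n p₁-low ∷ m≤n⇒m≤1+n p₂-low ∷ []) exhausted)
    ...   | inj₁ (q , q-isolated , q-low , (x≢q , ¬xq) ∷ (_ , ¬p₁q) ∷ (_ , ¬p₂q) ∷ []) =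
      Opening.opening x-isolated x-low ¬p₁x ¬p₂x q-isolated q-low x≢q ¬xq ¬p₁q ¬p₂q

  -- A port of Blocker-degree > K is abandoned, and Constructor starts afresh with a new edge.
  module Restart (f : ℕ) (next : Next f) {C B : Graph n} (I : Invariant C B) (fuel : n ≤ used C + suc f)
                 (port-high : K < deg B (port₁ I) ⊎ K < deg B (port₂ I)) where

    paid : restart-cost ≤ excess B (port₁ I) + excess B (port₂ I)
    paid = Sum.[ (λ K<p₁ → ≤-trans (∸-monoˡ-≤ (D + 4) (<⇒≤ K<p₁)) (m≤m+n _ _))
           , (λ K<p₂ → ≤-trans (∸-monoˡ-≤ (D + 4) (<⇒≤ K<p₂)) (m≤n+m _ _)) ] port-high

    restart : ∀ {y₁ y₂} → deg C y₁ ≡ 0 → deg B y₁ ≤ D → deg C y₂ ≡ 0 → deg B y₂ ≤ D → y₁ ≢ y₂ → ¬ Adj B y₁ y₂ → CWins s C B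
    restart {y₁} {y₂} y₁-isolated y₁-low y₂-isolated y₂-low y₁≢y₂ ¬y₁y₂ =
      c-move y₁ y₂ legal (next C′ B I′ fuel′ (s≤s (blocker-behind I)))
      where
      C′ : Graph n
      C′ = (y₁ , y₂) ∷ C
      legal : LegalC C B y₁ y₂
      legal = legal-move C B (y₁≢y₂ , isolated⇒¬Adj C y₁-isolated , ¬y₁y₂) (subcubic I)
                (≡-≤-trans y₁-isolated z≤n) (≡-≤-trans y₂-isolated z≤n)
      fuel′ : n ≤ used C′ + f
      fuel′ = ≤-trans fuel (≤-trans (≤-reflexive (+-suc (used C) f)) (+-monoˡ-≤ f (used-∷-isolated C y₁ y₂ y₁-isolated)))
      I′ : Invariant C′ B
      I′ = record
        { port₁ = y₁ ; port₂ = y₂ ; rounds = rounds I ; restarts = suc (restarts I)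
        ; subcubic = Subcubic-∷ C (subcubic I) (≡-≤-trans y₁-isolated z≤n) (≡-≤-trans y₂-isolated z≤n) y₁≢y₂
        ; ports-distinct = y₁≢y₂
        ; port₁-leaf = trans (deg-∷-fst C y₁≢y₂) (cong suc y₁-isolated)
        ; port₂-leaf = trans (deg-∷-snd C y₁≢y₂) (cong suc y₂-isolated)
        ; blocker-behind = m≤n⇒m≤1+n (blocker-behind I)
        ; balanced = Balanced-restart paid (≤-trans y₁-low (m≤m+n D 4)) (≤-trans y₂-low (m≤m+n D 4)) (balanced I)
        ; used-bound = ≤-trans (used-∷-+2 C y₁ y₂)
                         (≤-trans (+-monoˡ-≤ 2 (used-bound I)) (≤-reflexive (two-more (rounds I) (restarts I))))
        ; secured = ≤-trans (secured I) (triangles-⊑ {G = C} {C′} (⊑-step ⊑-refl)) }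
        where
        two-more : ∀ t w → 3 * t + 2 + 2 * w + 2 ≡ 3 * t + 2 + 2 * suc w
        two-more = solve-∀

    play : CWins s C B
    play with search D C B []
    ... | inj₂ exhausted = endgameᶜ C B (give-up C B I [] ⊑-refl ⊑-refl (blocker-behind I) (subcubic I)
                             (used-bound′ I) z≤n [] exhausted)
    ... | inj₁ (y₁ , y₁-isolated , y₁-low , []) with search D C B (y₁ ∷ [])
    ...   | inj₂ exhausted = endgameᶜ C B (give-up C B I (y₁ ∷ []) ⊑-refl ⊑-refl (blocker-behind I) (subcubic I)
                               (used-bound′ I) (s≤s z≤n) (m≤n⇒m≤1+n (≤-trans y₁-low D≤K) ∷ []) exhausted)
    ...   | inj₁ (y₂ , y₂-isolated , y₂-low , (y₁≢y₂ , ¬y₁y₂) ∷ []) =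
      restart y₁-isolated y₁-low y₂-isolated y₂-low y₁≢y₂ ¬y₁y₂

  mutual
    -- Blocker may move only while Constructor still has a legal move; two fresh vertices give one.
    strategyᴮ : ∀ f (C B : Graph n) → Invariant C B → n ≤ used C + f → length B < length C → BWins s C B
    strategyᴮ f C B I fuel B<C with search D C B []
    ... | inj₂ exhausted = endgameᴮ C B (give-up C B I [] ⊑-refl ⊑-refl (blocker-behind I) (subcubic I)
                             (used-bound′ I) z≤n [] exhausted)
    ... | inj₁ (x , x-isolated , x-low , []) with search D C B (x ∷ [])
    ...   | inj₂ exhausted = endgameᴮ C B (give-up C B I (x ∷ []) ⊑-refl ⊑-refl (blocker-behind I) (subcubic I)
                               (used-bound′ I) (s≤s z≤n) (m≤n⇒m≤1+n (≤-trans x-low D≤K) ∷ []) exhausted)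
    ...   | inj₁ (q , q-isolated , _ , (x≢q , ¬xq) ∷ []) =
      b-move (λ over → over (x , q , legal-move C B (x≢q , isolated⇒¬Adj C x-isolated , ¬xq) (subcubic I)
                                       (≡-≤-trans x-isolated z≤n) (≡-≤-trans q-isolated z≤n)))
             (λ u v uv → strategyᶜ f C ((u , v) ∷ B) (Invariant-∷ᴮ I (proj₁ uv) B<C) fuel)

    strategyᶜ : ∀ f (C B : Graph n) → Invariant C B → n ≤ used C + f → CWins s C B
    strategyᶜ zero    C B I fuel = endgameᶜ C B (give-up C B I [] ⊑-refl ⊑-refl (blocker-behind I) (subcubic I)
                                     (used-bound′ I) z≤n []
                                     (≤-trans fuel (≤-trans (≤-reflexive (+-identityʳ (used C))) (m≤m+n _ _))))
    strategyᶜ (suc f) C B I fuel with deg B (port₁ I) ≤? K | deg B (port₂ I) ≤? K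
    ... | yes p₁-low | yes p₂-low = Round.play f (strategyᴮ f) I fuel p₁-low p₂-low
    ... | no  p₁-high | _         = Restart.play f (strategyᴮ f) I fuel (inj₁ (≰⇒> p₁-high))
    ... | yes _ | no  p₂-high     = Restart.play f (strategyᴮ f) I fuel (inj₂ (≰⇒> p₂-high))

first-move : ∀ m D K s → D ≤ K → ScoreBound (2 + m) D K s → g≥ (2 + m) s
first-move m D K s D≤K score-bound =
  c-move zero (suc zero) (legal-move [] [] (0≢1 , (λ ()) , (λ ())) (λ _ → z≤n) z≤n z≤n)
    (strategyᴮ (2 + m) C₁ [] I (m≤n+m (2 + m) (used C₁)) (s≤s z≤n))
  where
  open Strategy (2 + m) D K s D≤K score-bound
  0≢1 : zero ≢ suc zero
  0≢1 ()
  C₁ : Graph (2 + m)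
  C₁ = (zero , suc zero) ∷ []
  I : Invariant C₁ []
  I = record
    { port₁ = zero ; port₂ = suc zero ; rounds = 0 ; restarts = 0
    ; subcubic = Subcubic-∷ [] (λ _ → z≤n) z≤n z≤n 0≢1 ; ports-distinct = 0≢1
    ; port₁-leaf = deg-∷-fst [] 0≢1 ; port₂-leaf = deg-∷-snd [] 0≢1
    ; blocker-behind = z≤n
    ; balanced = balanced-by (≤-reflexive (cong₂ _+_ (0∸n≡0 (D + 4)) (0∸n≡0 (D + 4))))
    ; used-bound = ≤-trans (used-∷-+2 {2 + m} [] zero (suc zero)) (≤-reflexive (cong (_+ 2) (used-[] {2 + m})))
    ; secured = z≤n }

-- Choice of the parameters

exhaustion : ∀ {n D K T W u h x b} → K ∸ (D + 4) ≡ 2 * suc D →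
             n ≤ u + (h + x) → u ≤ 3 * T + 4 + 2 * W → suc D * h ≤ 2 * b → W * (K ∸ (D + 4)) ≤ 2 * b →
             2 * b ≤ 3 * n → x ≤ 3 * suc (suc K) → suc D * n ≤ 3 * suc D * T + suc D * (10 + 3 * K) + 6 * n
exhaustion {n} {D} {K} {T} {W} {u} {h} {x} {b} gap n≤ u≤ h≤ W≤ 2b≤ x≤ = begin
  d * n                                                   ≤⟨ *-monoʳ-≤ d n≤ ⟩
  d * (u + (h + x))                                       ≡⟨ expand d u h x ⟩
  d * u + (d * h + d * x)                                 ≤⟨ +-mono-≤ (*-monoʳ-≤ d u≤) (+-mono-≤ h≤ (*-monoʳ-≤ d x≤)) ⟩
  d * (3 * T + 4 + 2 * W) + (2 * b + d * (3 * suc (suc K))) ≡⟨ regroup d T W b K ⟩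
  3 * d * T + 4 * d + W * (2 * d) + 2 * b + d * (3 * suc (suc K))
    ≤⟨ +-monoˡ-≤ (d * (3 * suc (suc K)))
         (+-mono-≤ (+-monoʳ-≤ (3 * d * T + 4 * d) (subst (λ g → W * g ≤ 2 * b) gap W≤)) 2b≤) ⟩
  3 * d * T + 4 * d + 2 * b + 3 * n + d * (3 * suc (suc K))
    ≤⟨ +-monoˡ-≤ (d * (3 * suc (suc K))) (+-monoˡ-≤ (3 * n) (+-monoʳ-≤ (3 * d * T + 4 * d) 2b≤)) ⟩
  3 * d * T + 4 * d + 3 * n + 3 * n + d * (3 * suc (suc K)) ≡⟨ collect d T n K ⟩
  3 * d * T + d * (10 + 3 * K) + 6 * n                   ∎
  where
  open ≤-Reasoning
  d = suc D
  expand : ∀ d u h x → d * (u + (h + x)) ≡ d * u + (d * h + d * x)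
  expand = solve-∀
  regroup : ∀ d T W b K → d * (3 * T + 4 + 2 * W) + (2 * b + d * (3 * suc (suc K)))
                        ≡ 3 * d * T + 4 * d + W * (2 * d) + 2 * b + d * (3 * suc (suc K))
  regroup = solve-∀
  collect : ∀ d T n K → 3 * d * T + 4 * d + 3 * n + 3 * n + d * (3 * suc (suc K)) ≡ 3 * d * T + d * (10 + 3 * K) + 6 * n
  collect = solve-∀

-- With D + 1 = 12(k + 1) and K ∸ (D + 4) = 2(D + 1), Blocker spoils at most n/6 + O(1) vertices,
-- so at least (1 - 1/(k + 1)) n/3 rounds are completed.
module Parameters (k : ℕ) where

  D K Q N : ℕ
  D = 12 * k + 11
  K = 3 * D + 6
  Q = suc D * (10 + 3 * K)
  N = Q + 36 * suc k + 2

  s : ℕ → ℕ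
  s n = k * n / (3 * suc k) + 1

  D≤K : D ≤ K
  D≤K = ≤-trans (m≤n*m D 3) (m≤m+n (3 * D) 6)

  gap : K ∸ (D + 4) ≡ 2 * suc D
  gap = trans (cong (_∸ (D + 4)) (K≡ D)) (m+n∸n≡m (2 * suc D) (D + 4))
    where
    K≡ : ∀ D → 3 * D + 6 ≡ 2 * suc D + (D + 4)
    K≡ = solve-∀

  s-ratio : ∀ n → k * n ≤ 3 * suc k * s n
  s-ratio n = begin
    k * n                                                  ≡⟨ m≡m%n+[m/n]*n (k * n) (3 * suc k) ⟩
    k * n % (3 * suc k) + k * n / (3 * suc k) * (3 * suc k) ≤⟨ +-monoˡ-≤ _ (<⇒≤ (m%n<n (k * n) (3 * suc k))) ⟩
    3 * suc k + k * n / (3 * suc k) * (3 * suc k)          ≡⟨ factor (suc k) (k * n / (3 * suc k)) ⟩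
    3 * suc k * s n                                        ∎
    where
    open ≤-Reasoning
    factor : ∀ c q → 3 * c + q * (3 * c) ≡ 3 * c * (q + 1)
    factor = solve-∀

  score-bound : ∀ n → N ≤ n → ScoreBound n D K (s n)
  score-bound n N≤n T W u h x b n≤ u≤ h≤ W≤ 2b≤ x≤ = *-cancelˡ-≤ (36 * suc k) (begin
    36 * suc k * s n                                   ≡⟨ unfold (suc k) (k * n / (3 * suc k)) ⟩
    12 * (k * n / (3 * suc k) * (3 * suc k)) + 36 * suc k
      ≤⟨ +-monoˡ-≤ (36 * suc k) (*-monoʳ-≤ 12 (m/n*n≤m (k * n) (3 * suc k))) ⟩
    12 * (k * n) + 36 * suc k                          ≤⟨ +-cancelʳ-≤ (Q + 6 * n) _ _ rounds-suffice ⟩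
    36 * suc k * T                                     ∎)
    where
    open ≤-Reasoning
    unfold : ∀ c q → 36 * c * (q + 1) ≡ 12 * (q * (3 * c)) + 36 * c
    unfold = solve-∀
    Q+36c≤6n : 36 * suc k + Q ≤ 6 * n
    Q+36c≤6n = ≤-trans (≤-reflexive (+-comm (36 * suc k) Q)) (≤-trans (m≤m+n _ 2) (≤-trans N≤n (m≤n*m n 6)))
    rounds-suffice : 12 * (k * n) + 36 * suc k + (Q + 6 * n) ≤ 36 * suc k * T + (Q + 6 * n)
    rounds-suffice = begin
      12 * (k * n) + 36 * suc k + (Q + 6 * n) ≡⟨ shuffle k n Q ⟩
      12 * (k * n) + 6 * n + (36 * suc k + Q) ≤⟨ +-monoʳ-≤ (12 * (k * n) + 6 * n) Q+36c≤6n ⟩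
      12 * (k * n) + 6 * n + 6 * n            ≡⟨ total k n ⟩
      suc D * n                               ≤⟨ exhaustion {n} {D} {K} {T} {W} {u} {h} {x} {b} gap n≤ u≤ h≤ W≤ 2b≤ x≤ ⟩
      3 * suc D * T + Q + 6 * n               ≡⟨ rounds k T Q n ⟩
      36 * suc k * T + (Q + 6 * n)            ∎
      where
      shuffle : ∀ k n Q → 12 * (k * n) + 36 * suc k + (Q + 6 * n) ≡ 12 * (k * n) + 6 * n + (36 * suc k + Q)
      shuffle = solve-∀
      total : ∀ k n → 12 * (k * n) + 6 * n + 6 * n ≡ suc (12 * k + 11) * n
      total = solve-∀
      rounds : ∀ k T Q n → 3 * suc (12 * k + 11) * T + Q + 6 * n ≡ 36 * suc k * T + (Q + 6 * n)
      rounds = solve-∀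

proposition3p5 : (k : ℕ) → ∃[ N ] ((n : ℕ) → N ≤ n →
                   ∃[ s ] (k * n ≤ 3 * suc k * s × g≥ n s))
proposition3p5 k = N , secured
  where
  open Parameters k
  2≤N : 2 ≤ N
  2≤N = m≤n+m 2 (Q + 36 * suc k)
  secured : (n : ℕ) → N ≤ n → ∃[ s ] (k * n ≤ 3 * suc k * s × g≥ n s)
  secured 0             N≤0 = ⊥-elim (1+n≰n (≤-trans 2≤N (≤-trans N≤0 z≤n)))
  secured 1             N≤1 = ⊥-elim (1+n≰n (≤-trans 2≤N N≤1))
  secured (suc (suc m)) N≤n = s (2 + m) , s-ratio (2 + m) , first-move m D K (s (2 + m)) D≤K (score-bound (2 + m) N≤n)
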